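{- Let $\mathcal M=(E,\rho)$ be a $q$-matroid with $\dim E=n$ and $P(\mathcal M)=(\mathbb PE,r)$ its projectivization matroid. Then for every $1\le j\le\frac{q^n-1}{q-1}$, $$A^{(j)}_{P(\mathcal M)}(x)=\begin{cases}A^{(i)}_{\mathcal M}(x) & \text{if } j=\frac{q^n-q^{n-i}}{q-1}\text{ for some }1\le i\le n,\\ 0&\text{otherwise.}\end{cases}$$
   Context: A $q$-matroid is a pair $(E,\rho)$ where $E$ is a finite-dimensional vector space over the finite field $\mathbb F_q$ and $\rho$ assigns to each subspace a nonnegative integer with $0\le\rho(U)\le\dim U$, monotonicity and submodularity. A non-degenerate symmetric bilinear form on $E$ is fixed and $\perp$ refers to it. $\mathbb PE$ is the set of lines of $E$; $P(\mathcal M)=(\mathbb PE,r)$ with $r(S)=\rho(\langle S\rangle)$, $\langle S\rangle$ the span of the union of lines in $S$. Contractions: $\mathcal M/U=(E/U,\rho')$ with $\rho'(X)=\rho(\pi^{ -1}(X))-\rho(U)$; for a matroid, $M/B=(S-B,r')$ with $r'(C)=r(C\cup B)-r(B)$. Characteristic polynomials: for a $q$-matroid $(E,\rho)$, $\chi(x)=\sum_{U\le E}\mu_{\mathcal L(E)}(\{0\},U)x^{\rho(E)-\rho(U)}$; for a matroid $(S,r)$, $\chi(x)=\sum_{A\subseteq S}(-1)^{|A|}x^{r(S)-r(A)}$. Weight enumerators: for a matroid $M=(S,r)$, $A^{(i)}_M(x)=\sum_{A\subseteq S,\,|A|=i}\chi_{M/(S-A)}(x)$; for a $q$-matroid $\mathcal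 M=(E,\rho)$, $A^{(i)}_{\mathcal M}(x)=\sum_{V\le E,\,\dim V=i}\chi_{\mathcal M/V^\perp}(x)$. -}

module Defs where

open import Data.Nat as ℕ using (ℕ; zero; suc; _∸_; _^_; _≤_; _≡ᵇ_; _≤ᵇ_; NonZero)
open import Data.Nat.DivMod using (_/_)
open import Data.Fin using (Fin; zero; suc)
open import Data.Fin.Properties using (_≟_)
open import Data.Vec as V using (Vec; []; _∷_)
open import Data.Vec.Properties using (≡-dec)
open import Data.List as L using (List; []; _∷_; filterᵇ; allFin; concatMap; length)
open import Data.Bool.ListAction using (all; any)
open import Data.Bool using (Bool; true; false; _∧_; _∨_; not; if_then_else_)
open import Data.Integer as ℤ using (ℤ)
open import Data.Fin.Subset as Sub using (Subset; _∩_; _∪_; ∁; ∣_∣; ⊤)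
open import Data.Empty using (⊥-elim)
open import Relation.Nullary using (¬_)
open import Relation.Nullary.Decidable using (⌊_⌋)
open import Relation.Binary.PropositionalEquality using (_≡_; _≢_; refl)
open import Algebra.Structures using (IsCommutativeRing)

-- Finite fields.  Every finite field with q elements is isomorphic to a
-- field structure on Fin q, so we take F_q to be a field structure on Fin q.

record FiniteField (q : ℕ) : Set where
  field
    _+_ _*_ : Fin q → Fin q → Fin q
    -_      : Fin q → Fin q
    0# 1#   : Fin q
    _⁻¹     : Fin q → Fin q
    isCommutativeRing : IsCommutativeRing _≡_ _+_ _*_ -_ 0# 1#
    0≢1     : 0# ≢ 1#
    ⁻¹-inverse : ∀ x → x ≢ 0# → x * (x ⁻¹) ≡ 1#

private
  fin1 : (a b : Fin 1) → a ≡ b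
  fin1 zero zero = refl

qm1-nonZero : ∀ {q} → FiniteField q → NonZero (q ∸ 1)
qm1-nonZero {zero} F with FiniteField.0# F
... | ()
qm1-nonZero {suc zero} F = ⊥-elim (FiniteField.0≢1 F (fin1 _ _))
qm1-nonZero {suc (suc k)} F = record { nonZero = _ }

vecsFrom : ∀ {A : Set} → List A → (m : ℕ) → List (Vec A m)
vecsFrom xs zero    = [] ∷ []
vecsFrom xs (suc m) = concatMap (λ x → L.map (x ∷_) (vecsFrom xs m)) xs

-- Polynomials in x with integer coefficients, as coefficient functions

Poly : Set
Poly = ℕ → ℤ

_≈ₚ_ : Poly → Poly → Set
p ≈ₚ r = ∀ k → p k ≡ r k

0ₚ : Poly
0ₚ _ = ℤ.0ℤ

mono : ℤ → ℕ → Poly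
mono c e k = if e ≡ᵇ k then c else ℤ.0ℤ

sumℤ : List ℤ → ℤ
sumℤ = L.foldr ℤ._+_ ℤ.0ℤ

Σₚ : ∀ {A : Set} → List A → (A → Poly) → Poly
Σₚ xs f k = sumℤ (L.map (λ a → f a k) xs)

module Matroid {m : ℕ} where

  allSubsets : List (Subset m)
  allSubsets = vecsFrom (true ∷ false ∷ []) m

  _⊆ᵇ_ : ∀ {k} → Subset k → Subset k → Bool
  [] ⊆ᵇ [] = true
  (a ∷ A) ⊆ᵇ (b ∷ B) = (not a ∨ b) ∧ (A ⊆ᵇ B)

  _─_ : Subset m → Subset m → Subset m
  S ─ B = S ∩ ∁ B

  χ : Subset m → (Subset m → ℕ) → Poly
  χ S r = Σₚ (filterᵇ (_⊆ᵇ S) allSubsets)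
             (λ A → mono (ℤ.-1ℤ ℤ.^ ∣ A ∣) (r S ∸ r A))

  contractRank : (Subset m → ℕ) → Subset m → Subset m → ℕ
  contractRank r B C = r (C ∪ B) ∸ r B

  χ/ : Subset m → (Subset m → ℕ) → Subset m → Poly
  χ/ S r B = χ (S ─ B) (contractRank r B)

  weightEnum : Subset m → (Subset m → ℕ) → ℕ → Poly
  weightEnum S r i =
    Σₚ (filterᵇ (λ A → (A ⊆ᵇ S) ∧ (∣ A ∣ ≡ᵇ i)) allSubsets) (λ A → χ/ S r (S ─ A))

-- Subsets of F_q^n, represented canonically as decision trees
-- (so that propositional equality is extensional equality of sets).

VSet : ℕ → ℕ → Set
VSet q zero    = Bool
VSet q (suc n) = Vec (VSet q n) q

_∈ᵇ_ : ∀ {q n} → Vec (Fin q) n → VSet q n → Bool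
_∈ᵇ_ {n = zero}  []       b = b
_∈ᵇ_ {n = suc n} (x ∷ v) t = v ∈ᵇ V.lookup t x

tabulateSet : ∀ {q n} → (Vec (Fin q) n → Bool) → VSet q n
tabulateSet {n = zero}  P = P []
tabulateSet {n = suc n} P = V.tabulate (λ x → tabulateSet (λ v → P (x ∷ v)))

allSets : ∀ q n → List (VSet q n)
allSets q zero    = true ∷ false ∷ []
allSets q (suc n) = vecsFrom (allSets q n) q

module QMatroid {q : ℕ} (F : FiniteField q) (n : ℕ) where
  open FiniteField F

  Vect : Set
  Vect = Vec (Fin q) n

  allV : List Vect
  allV = vecsFrom (allFin q) n

  0v : Vect
  0v = V.replicate n 0#

  _⊕_ : Vect → Vect → Vect
  _⊕_ = V.zipWith _+_

  _·_ : Fin q → Vect → Vect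
  c · v = V.map (c *_) v

  _==_ : Vect → Vect → Bool
  u == v = ⌊ ≡-dec _≟_ u v ⌋

  _=F_ : Fin q → Fin q → Bool
  a =F b = ⌊ a ≟ b ⌋

  Sets : Set
  Sets = VSet q n

  isSubspace : Sets → Bool
  isSubspace U =
    (0v ∈ᵇ U)
    ∧ all (λ u → all (λ v → not ((u ∈ᵇ U) ∧ (v ∈ᵇ U)) ∨ ((u ⊕ v) ∈ᵇ U)) allV) allV
    ∧ all (λ c → all (λ v → not (v ∈ᵇ U) ∨ ((c · v) ∈ᵇ U)) allV) (allFin q)

  subspaces : List Sets
  subspaces = filterᵇ isSubspace (allSets q n)

  _⊆ᵇ_ : Sets → Sets → Bool
  A ⊆ᵇ B = all (λ v → not (v ∈ᵇ A) ∨ (v ∈ᵇ B)) allV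

  card : Sets → ℕ
  card A = length (filterᵇ (_∈ᵇ A) allV)

  -- dim U = log_q |U|  (|U| = q^(dim U) for a subspace U ≤ F_q^n)
  dim : Sets → ℕ
  dim A = length (filterᵇ (λ k → q ^ k ≤ᵇ card A) (L.applyUpTo suc n))

  E : Sets
  E = tabulateSet (λ _ → true)

  zeroS : Sets
  zeroS = tabulateSet (_== 0v)

  span : (Vect → Bool) → Sets
  span P = tabulateSet (λ v →
    all (λ W → not (all (λ u → not (P u) ∨ (u ∈ᵇ W)) allV) ∨ (v ∈ᵇ W)) subspaces)

  _∩ₛ_ : Sets → Sets → Sets
  U ∩ₛ W = tabulateSet (λ v → (v ∈ᵇ U) ∧ (v ∈ᵇ W))

  _+ₛ_ : Sets → Sets → Sets
  U +ₛ W = span (λ v → (v ∈ᵇ U) ∨ (v ∈ᵇ W))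

  record IsNondegSymBilinear (B : Vect → Vect → Fin q) : Set where
    field
      symmetric : ∀ x y → B x y ≡ B y x
      additive  : ∀ x y z → B (x ⊕ y) z ≡ B x z + B y z
      homogeneous : ∀ c x z → B (c · x) z ≡ c * B x z
      nondegenerate : ∀ x → (∀ y → B x y ≡ 0#) → x ≡ 0v

  perp : (Vect → Vect → Fin q) → Sets → Sets
  perp B U = tabulateSet (λ x → all (λ v → not (v ∈ᵇ U) ∨ (B x v =F 0#)) allV)

  -- q-matroid axioms (rank function on subspaces; 0 ≤ ρ is automatic in ℕ)
  record IsQMatroid (ρ : Sets → ℕ) : Set where
    field
      bounded : ∀ U → isSubspace U ≡ true → ρ U ≤ dim U
      monotone : ∀ U W → isSubspace U ≡ true → isSubspace W ≡ true →
                 U ⊆ᵇ W ≡ true → ρ U ≤ ρ W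
      submodular : ∀ U W → isSubspace U ≡ true → isSubspace W ≡ true →
                   ρ (U +ₛ W) ℕ.+ ρ (U ∩ₛ W) ≤ ρ U ℕ.+ ρ W

  -- Möbius function of L(E), by its defining recursion
  --   μ(A,A) = 1,  μ(A,B) = - Σ_{A ≤ Z < B} μ(A,Z) for A < B,  0 otherwise.
  -- computed with fuel; fuel n+1 exceeds every chain length in L(E).
  mu : ℕ → Sets → Sets → ℤ
  mu zero    A B = ℤ.0ℤ
  mu (suc f) A B =
    if A ⊆ᵇ B
    then (if B ⊆ᵇ A then ℤ.1ℤ
          else ℤ.- sumℤ (L.map (mu f A)
                 (filterᵇ (λ Z → (A ⊆ᵇ Z) ∧ (Z ⊆ᵇ B) ∧ not (B ⊆ᵇ Z)) subspaces)))
    else ℤ.0ℤ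

  μ : Sets → Sets → ℤ
  μ = mu (suc n)

  -- The subspace lattice L(E/U) is identified with the interval [U, E] of
  -- L(E) via X ↦ π⁻¹(X) (so 0 ↦ U, E/U ↦ E, μ_{L(E/U)}(0,X) = μ(U, π⁻¹X)),
  -- and ρ'(X) = ρ(π⁻¹ X) - ρ(U).
  χ/ : (Sets → ℕ) → Sets → Poly
  χ/ ρ U = Σₚ (filterᵇ (U ⊆ᵇ_) subspaces)
             (λ W → mono (μ U W) ((ρ E ∸ ρ U) ∸ (ρ W ∸ ρ U)))

  χ : (Sets → ℕ) → Poly
  χ ρ = χ/ ρ zeroS

  weightEnum : (Vect → Vect → Fin q) → (Sets → ℕ) → ℕ → Poly
  weightEnum B ρ i =
    Σₚ (filterᵇ (λ W → dim W ≡ᵇ i) subspaces) (λ W → χ/ ρ (perp B W))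

  -- the projectivization P(M) = (PE, r): ground set = the lines of E
  lines : List Sets
  lines = filterᵇ (λ W → dim W ≡ᵇ 1) subspaces

  #lines : ℕ
  #lines = length lines

  ⟨_⟩ : Subset #lines → Sets
  ⟨ S ⟩ = span (λ v → any (λ i → V.lookup S i ∧ (v ∈ᵇ L.lookup lines i)) (allFin #lines))

  projRank : (Sets → ℕ) → Subset #lines → ℕ
  projRank ρ S = ρ ⟨ S ⟩

  projWeightEnum : (Sets → ℕ) → ℕ → Poly
  projWeightEnum ρ j = Matroid.weightEnum ⊤ (projRank ρ) j

  numLines : ℕ
  numLines = _/_ (q ^ n ∸ 1) (q ∸ 1) {{qm1-nonZero F}}

  projSize : ℕ → ℕ
  projSize i = _/_ (q ^ n ∸ q ^ (n ∸ i)) (q ∸ 1) {{qm1-nonZero F}}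

-- For A ⊆ PE put U = ⟨PE ∖ A⟩. Grouping the terms (-1)^|C| x^(…) of χ_{P(M)/(PE ∖ A)}, C ⊆ A,
-- by the span ⟨C ∪ (PE ∖ A)⟩ and applying inclusion–exclusion over the points of A shows that
-- χ_{P(M)/(PE ∖ A)} = χ_{M/U} when PE ∖ A is closed, i.e. A is the set of points off U, and that it
-- vanishes otherwise. Hence A^(j)_{P(M)} = Σ χ_{M/U} over the subspaces U with exactly j points of
-- PE off U. Counting the nonzero vectors on lines, a subspace of dimension d has (q^n - q^d)/(q - 1)
-- points off it, which determines d; so the sum is empty unless j = (q^n - q^(n-i))/(q - 1), when it
-- runs over dim U = n - i, and substituting U = V^⊥ (dim V = i) gives A^(i)_M.

module Submission where

open import Defs
open import Data.Nat using (ℕ; _≤_)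
open import Data.Fin using (Fin)
open import Data.Vec using (Vec)
open import Data.Product using (_×_; _,_)
open import Relation.Binary.PropositionalEquality using (_≡_; _≢_)


module BoolLemmas where

  open import Data.Bool using (true; false; _∨_; not)
  open import Data.Nat as ℕ using (ℕ; zero; suc)
  open import Relation.Binary.PropositionalEquality using (_≡_; _≢_; refl; sym; cong)

  true≢false : true ≢ false
  true≢false ()

  ⇒ᵇ-elim : ∀ {a b} → not a ∨ b ≡ true → a ≡ true → b ≡ true
  ⇒ᵇ-elim {true} b≡true refl = b≡true

  ⇒ᵇ-intro : ∀ {a b} → (a ≡ true → b ≡ true) → not a ∨ b ≡ true
  ⇒ᵇ-intro {true}  a⇒b = a⇒b refl
  ⇒ᵇ-intro {false} a⇒b = refl

  ⇔-true⇒≡ : ∀ {a b} → (a ≡ true → b ≡ true) → (b ≡ true → a ≡ true) → a ≡ b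
  ⇔-true⇒≡ {true}          a⇒b b⇒a = sym (a⇒b refl)
  ⇔-true⇒≡ {false} {true}  a⇒b b⇒a = b⇒a refl
  ⇔-true⇒≡ {false} {false} a⇒b b⇒a = refl

  ≡ᵇ⇒≡ : ∀ a b → (a ℕ.≡ᵇ b) ≡ true → a ≡ b
  ≡ᵇ⇒≡ zero    zero    _ = refl
  ≡ᵇ⇒≡ (suc a) (suc b) e = cong suc (≡ᵇ⇒≡ a b e)

  ≡⇒≡ᵇ : ∀ a b → a ≡ b → (a ℕ.≡ᵇ b) ≡ true
  ≡⇒≡ᵇ zero    _ refl = refl
  ≡⇒≡ᵇ (suc a) _ refl = ≡⇒≡ᵇ a a refl

  ≡ᵇ-cong : ∀ a b c d → (a ≡ b → c ≡ d) → (c ≡ d → a ≡ b) → (a ℕ.≡ᵇ b) ≡ (c ℕ.≡ᵇ d)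
  ≡ᵇ-cong a b c d a≡b⇒c≡d c≡d⇒a≡b = ⇔-true⇒≡
    (λ e → ≡⇒≡ᵇ c d (a≡b⇒c≡d (≡ᵇ⇒≡ a b e)))
    (λ e → ≡⇒≡ᵇ a b (c≡d⇒a≡b (≡ᵇ⇒≡ c d e)))

module ListSum where

  open import Data.Bool using (Bool; true; false; if_then_else_)
  open import Data.Integer as ℤ using (ℤ; 0ℤ; 1ℤ; _+_; _*_)
  open import Data.Integer.Properties as ℤP using ()
  open import Data.List using (List; []; _∷_; _++_; map; filterᵇ; concatMap; length)
  open import Data.List.Membership.Propositional using (_∈_)
  open import Data.List.Relation.Unary.Any using (here; there)
  open import Relation.Binary.PropositionalEquality
  open import Algebra.Properties.CommutativeSemigroup ℤP.+-commutativeSemigroup using (interchange)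

  Σ : ∀ {A : Set} → List A → (A → ℤ) → ℤ
  Σ xs f = sumℤ (map f xs)

  module _ {A : Set} where

    Σ-cong : (xs : List A) {f g : A → ℤ} → (∀ x → f x ≡ g x) → Σ xs f ≡ Σ xs g
    Σ-cong []       f≡g = refl
    Σ-cong (x ∷ xs) f≡g = cong₂ _+_ (f≡g x) (Σ-cong xs f≡g)

    Σ-cong-∈ : (xs : List A) {f g : A → ℤ} → (∀ x → x ∈ xs → f x ≡ g x) → Σ xs f ≡ Σ xs g
    Σ-cong-∈ []       f≡g = refl
    Σ-cong-∈ (x ∷ xs) f≡g = cong₂ _+_ (f≡g x (here refl)) (Σ-cong-∈ xs (λ y y∈xs → f≡g y (there y∈xs)))

    Σ-++ : (xs ys : List A) (f : A → ℤ) → Σ (xs ++ ys) f ≡ Σ xs f + Σ ys f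
    Σ-++ []       ys f = sym (ℤP.+-identityˡ _)
    Σ-++ (x ∷ xs) ys f = trans (cong (f x +_) (Σ-++ xs ys f)) (sym (ℤP.+-assoc (f x) _ _))

    Σ-zero : (xs : List A) → Σ xs (λ _ → 0ℤ) ≡ 0ℤ
    Σ-zero []       = refl
    Σ-zero (x ∷ xs) = trans (ℤP.+-identityˡ _) (Σ-zero xs)

    Σ-const : (xs : List A) (k : ℤ) → Σ xs (λ _ → k) ≡ ℤ.+ length xs * k
    Σ-const []       k = sym (ℤP.*-zeroˡ k)
    Σ-const (x ∷ xs) k = begin
      k + Σ xs (λ _ → k)            ≡⟨ cong₂ _+_ (sym (ℤP.*-identityˡ k)) (Σ-const xs k) ⟩
      1ℤ * k + ℤ.+ length xs * k    ≡⟨ sym (ℤP.*-distribʳ-+ k 1ℤ (ℤ.+ length xs)) ⟩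
      (1ℤ + ℤ.+ length xs) * k      ≡⟨ cong (_* k) (sym (ℤP.pos-+ 1 (length xs))) ⟩
      ℤ.+ length (x ∷ xs) * k       ∎
      where open ≡-Reasoning

    Σ-distrib-+ : (xs : List A) (f g : A → ℤ) → Σ xs (λ x → f x + g x) ≡ Σ xs f + Σ xs g
    Σ-distrib-+ []       f g = refl
    Σ-distrib-+ (x ∷ xs) f g =
      trans (cong (f x + g x +_) (Σ-distrib-+ xs f g)) (interchange (f x) (g x) (Σ xs f) (Σ xs g))

    Σ-*ˡ : (xs : List A) (c : ℤ) (f : A → ℤ) → Σ xs (λ x → c * f x) ≡ c * Σ xs f
    Σ-*ˡ []       c f = sym (ℤP.*-zeroʳ c)
    Σ-*ˡ (x ∷ xs) c f =
      trans (cong (c * f x +_) (Σ-*ˡ xs c f)) (sym (ℤP.*-distribˡ-+ c (f x) (Σ xs f)))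

    Σ-filterᵇ : (p : A → Bool) (xs : List A) (f : A → ℤ) →
                Σ (filterᵇ p xs) f ≡ Σ xs (λ x → if p x then f x else 0ℤ)
    Σ-filterᵇ p []       f = refl
    Σ-filterᵇ p (x ∷ xs) f with p x
    ... | true  = cong (f x +_) (Σ-filterᵇ p xs f)
    ... | false = trans (Σ-filterᵇ p xs f) (sym (ℤP.+-identityˡ _))

    Σ-if : (b : Bool) (xs : List A) (f : A → ℤ) →
           Σ xs (λ x → if b then f x else 0ℤ) ≡ (if b then Σ xs f else 0ℤ)
    Σ-if true  xs f = refl
    Σ-if false xs f = Σ-zero xs

    length-filterᵇ-Σ : (p : A → Bool) (xs : List A) →
                       ℤ.+ length (filterᵇ p xs) ≡ Σ xs (λ x → if p x then 1ℤ else 0ℤ)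
    length-filterᵇ-Σ p []       = refl
    length-filterᵇ-Σ p (x ∷ xs) with p x
    ... | true  = trans (sym (ℤP.pos-+ 1 (length (filterᵇ p xs)))) (cong (1ℤ +_) (length-filterᵇ-Σ p xs))
    ... | false = trans (length-filterᵇ-Σ p xs) (sym (ℤP.+-identityˡ _))

  Σ-map : ∀ {A B : Set} (h : A → B) (xs : List A) (f : B → ℤ) → Σ (map h xs) f ≡ Σ xs (λ x → f (h x))
  Σ-map h []       f = refl
  Σ-map h (x ∷ xs) f = cong (f (h x) +_) (Σ-map h xs f)

  Σ-concatMap : ∀ {A B : Set} (g : A → List B) (xs : List A) (f : B → ℤ) →
                Σ (concatMap g xs) f ≡ Σ xs (λ x → Σ (g x) f)
  Σ-concatMap g []       f = refl
  Σ-concatMap g (x ∷ xs) f =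
    trans (Σ-++ (g x) (concatMap g xs) f) (cong (Σ (g x) f +_) (Σ-concatMap g xs f))

  Σ-swap : ∀ {A B : Set} (xs : List A) (ys : List B) (f : A → B → ℤ) →
           Σ xs (λ x → Σ ys (f x)) ≡ Σ ys (λ y → Σ xs (λ x → f x y))
  Σ-swap []       ys f = sym (Σ-zero ys)
  Σ-swap (x ∷ xs) ys f =
    trans (cong (Σ ys (f x) +_) (Σ-swap xs ys f)) (sym (Σ-distrib-+ ys (f x) (λ y → Σ xs (λ x' → f x' y))))

module Enumeration where

  open ListSum
  open BoolLemmas
  open import Data.Nat as ℕ using (zero; suc; _≤_; _*_; _^_; z≤n; s≤s)
  open import Data.Nat.Properties using (m≤n⇒m≤1+n)
  open import Data.Integer using (ℤ; 0ℤ; 1ℤ; _+_)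
  open import Data.Integer.Properties as ℤP using ()
  open import Data.List using (List; []; _∷_; map; filterᵇ; concatMap; allFin; tabulate; length)
  open import Data.List.Properties as ListP using ()
  open import Data.Vec using (Vec; []; _∷_)
  open import Data.Fin using (Fin; zero; suc)
  open import Data.Fin.Properties using (_≟_)
  open import Data.Bool using (Bool; true; false; _∧_; if_then_else_)
  open import Data.Bool.Properties using (if-∧; if-cong; if-swap-then)
  open import Data.Bool.ListAction using (all; any)
  open import Data.Empty using (⊥-elim)
  open import Data.Product using (∃; _×_; _,_)
  open import Data.List.Membership.Propositional using (_∈_)
  open import Data.List.Membership.Propositional.Properties using (∈-++⁺ˡ; ∈-++⁺ʳ; ∈-map⁺)
  open import Data.List.Relation.Unary.Any using (here; there)
  open import Relation.Nullary using (yes; no)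
  open import Relation.Nullary.Decidable using (⌊_⌋)
  open import Relation.Binary.PropositionalEquality

  iverson : Bool → ℤ
  iverson b = if b then 1ℤ else 0ℤ

  module _ {A : Set} where

    all-sound : (p : A → Bool) {xs : List A} → all p xs ≡ true → ∀ {x} → x ∈ xs → p x ≡ true
    all-sound p {y ∷ xs} h (here refl) with p y
    ... | true = refl
    all-sound p {y ∷ xs} h (there x∈xs) with p y
    ... | true = all-sound p h x∈xs

    all-complete : (p : A → Bool) (xs : List A) → (∀ x → x ∈ xs → p x ≡ true) → all p xs ≡ true
    all-complete p []       h = refl
    all-complete p (x ∷ xs) h rewrite h x (here refl) = all-complete p xs (λ y y∈xs → h y (there y∈xs))

    all-false⇒∃ : (p : A → Bool) (xs : List A) → all p xs ≡ false → ∃ λ x → x ∈ xs × p x ≡ false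
    all-false⇒∃ p (x ∷ xs) h with p x in px
    ... | true  = let (y , y∈xs , py) = all-false⇒∃ p xs h in y , there y∈xs , py
    ... | false = x , here refl , px

    any-complete : (p : A → Bool) {xs : List A} {x : A} → x ∈ xs → p x ≡ true → any p xs ≡ true
    any-complete p {y ∷ xs} (here refl) px rewrite px = refl
    any-complete p {y ∷ xs} (there x∈xs) px with p y
    ... | true  = refl
    ... | false = any-complete p x∈xs px

    any-sound : (p : A → Bool) (xs : List A) → any p xs ≡ true → ∃ λ x → x ∈ xs × p x ≡ true
    any-sound p (x ∷ xs) h with p x in px
    ... | true  = x , here refl , px
    ... | false = let (y , y∈xs , py) = any-sound p xs h in y , there y∈xs , py

    ∈-filterᵇ⁺ : (p : A → Bool) {xs : List A} {x : A} → x ∈ xs → p x ≡ true → x ∈ filterᵇ p xs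
    ∈-filterᵇ⁺ p {y ∷ xs} (here refl) px with p y
    ∈-filterᵇ⁺ p {y ∷ xs} (here refl) refl | true = here refl
    ∈-filterᵇ⁺ p {y ∷ xs} (there x∈xs) px with p y
    ... | true  = there (∈-filterᵇ⁺ p x∈xs px)
    ... | false = ∈-filterᵇ⁺ p x∈xs px

    ∈-filterᵇ⁻ : (p : A → Bool) {xs : List A} {x : A} → x ∈ filterᵇ p xs → x ∈ xs × p x ≡ true
    ∈-filterᵇ⁻ p {y ∷ xs} x∈ with p y in py
    ∈-filterᵇ⁻ p {y ∷ xs} (here refl) | true = here refl , py
    ∈-filterᵇ⁻ p {y ∷ xs} (there x∈) | true  = let (x∈xs , px) = ∈-filterᵇ⁻ p {xs} x∈ in there x∈xs , px
    ... | false = let (x∈xs , px) = ∈-filterᵇ⁻ p {xs} x∈ in there x∈xs , px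

  record IsEnumeration {A : Set} (_≟ᵇ_ : A → A → Bool) (xs : List A) : Set where
    field
      sound    : ∀ a b → a ≟ᵇ b ≡ true → a ≡ b
      complete : ∀ a → a ≟ᵇ a ≡ true
      Σ-single : ∀ a (c : ℤ) → Σ xs (λ x → if x ≟ᵇ a then c else 0ℤ) ≡ c

    Σ-pick : ∀ a (f : A → ℤ) → Σ xs (λ x → if x ≟ᵇ a then f x else 0ℤ) ≡ f a
    Σ-pick a f = trans (Σ-cong xs f≡fa) (Σ-single a (f a))
      where
      f≡fa : ∀ x → (if x ≟ᵇ a then f x else 0ℤ) ≡ (if x ≟ᵇ a then f a else 0ℤ)
      f≡fa x with x ≟ᵇ a in x≟a
      ... | true  = cong f (sound x a x≟a)
      ... | false = refl

    Σ-reindex : (σ τ : A → A) → (∀ x → τ (σ x) ≡ x) → (∀ y → σ (τ y) ≡ y) →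
                (f : A → ℤ) → Σ xs (λ x → f (σ x)) ≡ Σ xs f
    Σ-reindex σ τ τσ στ f = begin
      Σ xs (λ x → f (σ x))
        ≡⟨ Σ-cong xs (λ x → sym (Σ-pick (σ x) f)) ⟩
      Σ xs (λ x → Σ xs (λ y → if y ≟ᵇ σ x then f y else 0ℤ))
        ≡⟨ Σ-swap xs xs _ ⟩
      Σ xs (λ y → Σ xs (λ x → if y ≟ᵇ σ x then f y else 0ℤ))
        ≡⟨ Σ-cong xs (λ y → trans (Σ-cong xs (λ x → if-cong (inverse y x)))
                                  (Σ-single (τ y) (f y))) ⟩
      Σ xs f ∎
      where
      open ≡-Reasoning
      inverse : ∀ y x → y ≟ᵇ σ x ≡ x ≟ᵇ τ y
      inverse y x with y ≟ᵇ σ x in e₁ | x ≟ᵇ τ y in e₂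
      ... | true  | true  = refl
      ... | false | false = refl
      ... | true  | false with sound _ _ e₁
      ...   | refl = trans (sym (complete x)) (trans (cong (x ≟ᵇ_) (sym (τσ x))) e₂)
      inverse y x | false | true with sound _ _ e₂
      ...   | refl = trans (sym e₁) (trans (cong (y ≟ᵇ_) (στ y)) (complete y))

    iverson-any : (p : A → Bool) → (∀ a b → p a ≡ true → p b ≡ true → a ≡ b) →
                  iverson (any p xs) ≡ Σ xs (λ x → iverson (p x))
    iverson-any p unique with any p xs in anyp
    ... | false = sym (none xs anyp)
      where
      none : ∀ ys → any p ys ≡ false → Σ ys (λ x → iverson (p x)) ≡ 0ℤ
      none []       _ = refl
      none (y ∷ ys) h with p y
      ... | false = trans (ℤP.+-identityˡ _) (none ys h)
    ... | true with any-sound p xs anyp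
    ...   | a , _ , pa = sym (trans (Σ-cong xs p≡a) (Σ-single a 1ℤ))
      where
      p≡a : ∀ x → iverson (p x) ≡ (if x ≟ᵇ a then 1ℤ else 0ℤ)
      p≡a x with p x in px | x ≟ᵇ a in x≟a
      ... | true  | true  = refl
      ... | false | false = refl
      ... | true  | false = ⊥-elim (true≢false (trans (sym (complete a)) (trans (cong (_≟ᵇ a) (sym (unique x a px pa))) x≟a)))
      ... | false | true  = ⊥-elim (true≢false (trans (sym pa) (trans (cong p (sym (sound x a x≟a))) px)))

  eqBool : Bool → Bool → Bool
  eqBool true  true  = true
  eqBool false false = true
  eqBool _     _     = false

  eqFin : ∀ {q} → Fin q → Fin q → Bool
  eqFin a b = ⌊ a ≟ b ⌋

  eqVec : ∀ {A : Set} (eq : A → A → Bool) {m} → Vec A m → Vec A m → Bool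
  eqVec eq []      []      = true
  eqVec eq (x ∷ u) (y ∷ v) = eq x y ∧ eqVec eq u v

  eqSet : ∀ {q n} → VSet q n → VSet q n → Bool
  eqSet {n = zero}  = eqBool
  eqSet {n = suc n} = eqVec (eqSet {n = n})

  eqFin-sound : ∀ {q} (a b : Fin q) → eqFin a b ≡ true → a ≡ b
  eqFin-sound a b _ with a ≟ b
  ... | yes a≡b = a≡b

  eqFin-refl : ∀ {q} (a : Fin q) → eqFin a a ≡ true
  eqFin-refl a with a ≟ a
  ... | yes _ = refl
  ... | no a≢a = ⊥-elim (a≢a refl)

  Σ-tabulate : ∀ {A : Set} {k} (g : Fin k → A) (f : A → ℤ) → Σ (tabulate g) f ≡ sumℤ (tabulate (λ i → f (g i)))
  Σ-tabulate g f = cong sumℤ (ListP.map-tabulate g f)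

  bool-enumeration : IsEnumeration eqBool (true ∷ false ∷ [])
  bool-enumeration = record { sound = sound ; complete = complete ; Σ-single = single }
    where
    sound : ∀ a b → eqBool a b ≡ true → a ≡ b
    sound true  true  _ = refl
    sound false false _ = refl
    complete : ∀ a → eqBool a a ≡ true
    complete true  = refl
    complete false = refl
    single : ∀ a c → Σ (true ∷ false ∷ []) (λ x → if eqBool x a then c else 0ℤ) ≡ c
    single true  c = ℤP.+-identityʳ c
    single false c = trans (ℤP.+-identityˡ _) (ℤP.+-identityʳ c)

  fin-enumeration : ∀ q → IsEnumeration (eqFin {q}) (allFin q)
  fin-enumeration q = record { sound = eqFin-sound ; complete = eqFin-refl ; Σ-single = single q }
    where
    zeros : ∀ k → sumℤ (tabulate {n = k} (λ _ → 0ℤ)) ≡ 0ℤ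
    zeros zero    = refl
    zeros (suc k) = trans (ℤP.+-identityˡ _) (zeros k)
    eqFin-suc : ∀ {k} (i a : Fin k) → eqFin (suc i) (suc a) ≡ eqFin i a
    eqFin-suc i a with i ≟ a
    ... | yes _ = refl
    ... | no _  = refl
    single : ∀ k (a : Fin k) c → Σ (allFin k) (λ x → if eqFin x a then c else 0ℤ) ≡ c
    single (suc k) zero c =
      trans (cong (c +_) (trans (Σ-tabulate {k = k} suc (λ x → if eqFin x zero then c else 0ℤ)) (zeros k)))
            (ℤP.+-identityʳ c)
    single (suc k) (suc a) c = begin
      0ℤ + Σ (tabulate suc) (λ x → if eqFin x (suc a) then c else 0ℤ)
        ≡⟨ ℤP.+-identityˡ _ ⟩
      Σ (tabulate suc) (λ x → if eqFin x (suc a) then c else 0ℤ)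
        ≡⟨ Σ-tabulate {k = k} suc _ ⟩
      sumℤ (tabulate (λ i → if eqFin (suc i) (suc a) then c else 0ℤ))
        ≡⟨ cong sumℤ (ListP.tabulate-cong {n = k} (λ i → if-cong (eqFin-suc i a))) ⟩
      sumℤ (tabulate (λ i → if eqFin i a then c else 0ℤ))
        ≡⟨ sym (Σ-tabulate {k = k} (λ i → i) _) ⟩
      Σ (allFin k) (λ x → if eqFin x a then c else 0ℤ)
        ≡⟨ single k a c ⟩
      c ∎
      where open ≡-Reasoning

  vecsFrom-enumeration : ∀ {A : Set} {eq : A → A → Bool} {xs : List A} →
                         IsEnumeration eq xs → ∀ m → IsEnumeration (eqVec eq {m}) (vecsFrom xs m)
  vecsFrom-enumeration {A} {eq} {xs} enum m = record { sound = sound ; complete = complete ; Σ-single = single m }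
    where
    module E = IsEnumeration enum
    sound : ∀ {m} (a b : Vec A m) → eqVec eq a b ≡ true → a ≡ b
    sound []      []      _ = refl
    sound (x ∷ u) (y ∷ v) e with eq x y in x≟y
    ... | true = cong₂ _∷_ (E.sound x y x≟y) (sound u v e)
    complete : ∀ {m} (a : Vec A m) → eqVec eq a a ≡ true
    complete []      = refl
    complete (x ∷ u) rewrite E.complete x = complete u
    single : ∀ m (a : Vec A m) c → Σ (vecsFrom xs m) (λ x → if eqVec eq x a then c else 0ℤ) ≡ c
    single zero    []        c = ℤP.+-identityʳ c
    single (suc m) (a₀ ∷ a') c = begin
      Σ (concatMap (λ x → map (x ∷_) (vecsFrom xs m)) xs) f
        ≡⟨ Σ-concatMap _ xs f ⟩
      Σ xs (λ x → Σ (map (x ∷_) (vecsFrom xs m)) f)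
        ≡⟨ Σ-cong xs (λ x → Σ-map (x ∷_) (vecsFrom xs m) f) ⟩
      Σ xs (λ x → Σ (vecsFrom xs m) (λ v → f (x ∷ v)))
        ≡⟨ Σ-cong xs (λ x → trans (Σ-cong (vecsFrom xs m) (λ v → trans (if-∧ (eq x a₀)) (if-swap-then (eq x a₀) (eqVec eq v a'))))
                                  (single m a' _)) ⟩
      Σ xs (λ x → if eq x a₀ then c else 0ℤ)
        ≡⟨ E.Σ-single a₀ c ⟩
      c ∎
      where
      open ≡-Reasoning
      f : Vec A (suc m) → ℤ
      f x = if eqVec eq x (a₀ ∷ a') then c else 0ℤ

  vecsFrom-∈ : ∀ {A : Set} {xs : List A} → (∀ x → x ∈ xs) → ∀ {m} (v : Vec A m) → v ∈ vecsFrom xs m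
  vecsFrom-∈ {xs = xs} ∈xs []              = here refl
  vecsFrom-∈ {xs = xs} ∈xs {suc m} (x ∷ v) = go xs (∈xs x)
    where
    go : ∀ ys → x ∈ ys → (x ∷ v) ∈ concatMap (λ y → map (y ∷_) (vecsFrom xs m)) ys
    go (y ∷ ys) (here refl) = ∈-++⁺ˡ (∈-map⁺ (x ∷_) (vecsFrom-∈ ∈xs v))
    go (y ∷ ys) (there x∈ys) = ∈-++⁺ʳ _ (go ys x∈ys)

  allSets-enumeration : ∀ q n → IsEnumeration (eqSet {q} {n}) (allSets q n)
  allSets-enumeration q zero    = bool-enumeration
  allSets-enumeration q (suc n) = vecsFrom-enumeration (allSets-enumeration q n) q

  ∈-allSets : ∀ q n (A : VSet q n) → A ∈ allSets q n
  ∈-allSets q zero    true  = here refl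
  ∈-allSets q zero    false = there (here refl)
  ∈-allSets q (suc n) A     = vecsFrom-∈ (∈-allSets q n) A

  length-vecsFrom : ∀ {A : Set} (xs : List A) m → length (vecsFrom xs m) ≡ length xs ^ m
  length-vecsFrom xs zero    = refl
  length-vecsFrom xs (suc m) = length-concatMap xs
    where
    length-concatMap : ∀ ys → length (concatMap (λ x → map (x ∷_) (vecsFrom xs m)) ys) ≡ length ys * length xs ^ m
    length-concatMap []       = refl
    length-concatMap (y ∷ ys) = trans (ListP.length-++ (map (y ∷_) (vecsFrom xs m)))
      (cong₂ ℕ._+_ (trans (ListP.length-map _ (vecsFrom xs m)) (length-vecsFrom xs m)) (length-concatMap ys))

  module _ {A : Set} where

    length-filterᵇ-mono : (p r : A → Bool) → (∀ x → p x ≡ true → r x ≡ true) →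
                          ∀ xs → length (filterᵇ p xs) ≤ length (filterᵇ r xs)
    length-filterᵇ-mono p r p⇒r []       = z≤n
    length-filterᵇ-mono p r p⇒r (x ∷ xs) with p x in px | r x in rx
    ... | true  | true  = s≤s (length-filterᵇ-mono p r p⇒r xs)
    ... | true  | false = ⊥-elim (true≢false (trans (sym (p⇒r x px)) rx))
    ... | false | true  = m≤n⇒m≤1+n (length-filterᵇ-mono p r p⇒r xs)
    ... | false | false = length-filterᵇ-mono p r p⇒r xs

    length-filterᵇ-pos : (p : A → Bool) {xs : List A} {x : A} → x ∈ xs → p x ≡ true → 1 ≤ length (filterᵇ p xs)
    length-filterᵇ-pos p x∈xs px = nonempty (∈-filterᵇ⁺ p x∈xs px)
      where
      nonempty : ∀ {x : A} {ys} → x ∈ ys → 1 ≤ length ys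
      nonempty (here _)  = s≤s z≤n
      nonempty (there _) = s≤s z≤n

module VSetProperties where

  open import Data.Nat using (ℕ; zero; suc)
  open import Data.Fin using (Fin)
  open import Data.Bool using (Bool)
  open import Data.Vec using (Vec; []; _∷_; lookup)
  open import Data.Vec.Properties using (tabulate∘lookup; tabulate-cong; lookup∘tabulate)
  open import Relation.Binary.PropositionalEquality

  lookup-ext : ∀ {A : Set} {m} (u v : Vec A m) → (∀ i → lookup u i ≡ lookup v i) → u ≡ v
  lookup-ext u v u≗v = trans (sym (tabulate∘lookup u)) (trans (tabulate-cong u≗v) (tabulate∘lookup v))

  module _ {q : ℕ} where

    ∈ᵇ-tabulateSet : ∀ {m} (P : Vec (Fin q) m → Bool) v → v ∈ᵇ tabulateSet P ≡ P v
    ∈ᵇ-tabulateSet {zero}  P []      = refl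
    ∈ᵇ-tabulateSet {suc m} P (x ∷ v)
      rewrite lookup∘tabulate (λ x → tabulateSet (λ v → P (x ∷ v))) x = ∈ᵇ-tabulateSet (λ v → P (x ∷ v)) v

    VSet-ext : ∀ {m} (A B : VSet q m) → (∀ v → v ∈ᵇ A ≡ v ∈ᵇ B) → A ≡ B
    VSet-ext {zero}  A B A≗B = A≗B []
    VSet-ext {suc m} A B A≗B = lookup-ext A B (λ i → VSet-ext (lookup A i) (lookup B i) (λ v → A≗B (i ∷ v)))

module IndexSubset where

  open ListSum
  open Enumeration
  open import Data.Nat using (ℕ; zero; suc)
  open import Data.Integer as ℤ using (ℤ; 0ℤ; -1ℤ)
  open import Data.Integer.Properties as ℤP using ()
  open import Data.List using (List; []; _∷_; map; concatMap)
  open import Data.Vec using ([]; _∷_; lookup)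
  open import Data.Vec.Properties using (lookup-zipWith; lookup-replicate; lookup-map)
  open import Data.Fin using (zero; suc)
  open import Data.Fin.Subset using (Subset; _∩_; _∪_; ∁; ∣_∣; ⊤)
  open import Data.Bool using (Bool; true; false; _∧_; _∨_; not; if_then_else_)
  open import Data.Bool.Properties using (∧-zeroʳ)
  open import Relation.Binary.PropositionalEquality

  infix 7 _⊆ˢ_

  _⊆ˢ_ : ∀ {k} → Subset k → Subset k → Bool
  []      ⊆ˢ []      = true
  (a ∷ A) ⊆ˢ (b ∷ B) = (not a ∨ b) ∧ (A ⊆ˢ B)

  -- Matroid._⊆ᵇ_ carries an unused module parameter m; this removes it.
  ⊆ᵇ≡⊆ˢ : ∀ {m k} (S T : Subset k) → Matroid._⊆ᵇ_ {m} S T ≡ (S ⊆ˢ T)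
  ⊆ᵇ≡⊆ˢ []      []      = refl
  ⊆ᵇ≡⊆ˢ {m} (a ∷ S) (b ∷ T) = cong ((not a ∨ b) ∧_) (⊆ᵇ≡⊆ˢ {m} S T)

  isEmpty : ∀ {k} → Subset k → Bool
  isEmpty []      = true
  isEmpty (a ∷ S) = not a ∧ isEmpty S

  sign : ∀ {k} → Subset k → ℤ
  sign C = -1ℤ ℤ.^ ∣ C ∣

  module _ {k : ℕ} where

    lookup-∩ : ∀ (S T : Subset k) i → lookup (S ∩ T) i ≡ (lookup S i ∧ lookup T i)
    lookup-∩ S T i = lookup-zipWith _∧_ i S T

    lookup-∪ : ∀ (S T : Subset k) i → lookup (S ∪ T) i ≡ (lookup S i ∨ lookup T i)
    lookup-∪ S T i = lookup-zipWith _∨_ i S T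

    lookup-⊤ : ∀ i → lookup (⊤ {k}) i ≡ true
    lookup-⊤ i = lookup-replicate i true

    lookup-─ : ∀ (S T : Subset k) i → lookup (Matroid._─_ {k} S T) i ≡ (lookup S i ∧ not (lookup T i))
    lookup-─ S T i = trans (lookup-∩ S (∁ T) i) (cong (lookup S i ∧_) (lookup-map i not T))

  ⊆ˢ⇒⊆ : ∀ {k} (S T : Subset k) → S ⊆ˢ T ≡ true → ∀ i → lookup S i ≡ true → lookup T i ≡ true
  ⊆ˢ⇒⊆ (true ∷ S)  (true ∷ T)  _   zero    _   = refl
  ⊆ˢ⇒⊆ (false ∷ S) (b ∷ T)     _   zero    ()
  ⊆ˢ⇒⊆ (true ∷ S)  (false ∷ T) ()  zero    _
  ⊆ˢ⇒⊆ (a ∷ S)     (b ∷ T)     S⊆T (suc i) Si = ⊆ˢ⇒⊆ S T (tail-⊆ a b S⊆T) i Si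
    where
    tail-⊆ : ∀ a b → (not a ∨ b) ∧ (S ⊆ˢ T) ≡ true → S ⊆ˢ T ≡ true
    tail-⊆ false _     h = h
    tail-⊆ true  true  h = h

  ⊆⇒⊆ˢ : ∀ {k} (S T : Subset k) → (∀ i → lookup S i ≡ true → lookup T i ≡ true) → S ⊆ˢ T ≡ true
  ⊆⇒⊆ˢ []      []      _   = refl
  ⊆⇒⊆ˢ (a ∷ S) (b ∷ T) S⊆T = cong₂ _∧_ (head-⊆ a b (S⊆T zero)) (⊆⇒⊆ˢ S T (λ i → S⊆T (suc i)))
    where
    head-⊆ : ∀ a b → (a ≡ true → b ≡ true) → not a ∨ b ≡ true
    head-⊆ false _ _ = refl
    head-⊆ true  b h = h refl

  isEmpty⇒lookup : ∀ {k} (S : Subset k) → isEmpty S ≡ true → ∀ i → lookup S i ≡ false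
  isEmpty⇒lookup (false ∷ S) _ zero    = refl
  isEmpty⇒lookup (false ∷ S) e (suc i) = isEmpty⇒lookup S e i

  lookup⇒isEmpty : ∀ {k} (S : Subset k) → (∀ i → lookup S i ≡ false) → isEmpty S ≡ true
  lookup⇒isEmpty []      _ = refl
  lookup⇒isEmpty (a ∷ S) h rewrite h zero = lookup⇒isEmpty S (λ i → h (suc i))

  ⊆ˢ-⊤ : ∀ {k} (S : Subset k) → S ⊆ˢ ⊤ ≡ true
  ⊆ˢ-⊤ []      = refl
  ⊆ˢ-⊤ (a ∷ S) rewrite ⊆ˢ-⊤ S with a
  ... | true  = refl
  ... | false = refl

  ∪-⊆ˢ : ∀ {k} (C S T : Subset k) → (C ∪ S) ⊆ˢ T ≡ (C ⊆ˢ T ∧ S ⊆ˢ T)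
  ∪-⊆ˢ []      []      []      = refl
  ∪-⊆ˢ (c ∷ C) (s ∷ S) (t ∷ T) rewrite ∪-⊆ˢ C S T = head c s t (C ⊆ˢ T) (S ⊆ˢ T)
    where
    head : ∀ c s t x y → (not (c ∨ s) ∨ t) ∧ (x ∧ y) ≡ ((not c ∨ t) ∧ x) ∧ ((not s ∨ t) ∧ y)
    head true  true  true  x y = refl
    head true  false true  x y = refl
    head true  s     false x y = refl
    head false true  true  x y = refl
    head false true  false x y = sym (∧-zeroʳ x)
    head false false t     x y = refl

  ⊆ˢ-∩ : ∀ {k} (C A D : Subset k) → (C ⊆ˢ A ∧ C ⊆ˢ D) ≡ C ⊆ˢ (A ∩ D)
  ⊆ˢ-∩ []      []      []      = refl
  ⊆ˢ-∩ (c ∷ C) (a ∷ A) (d ∷ D) rewrite sym (⊆ˢ-∩ C A D) = head c a d (C ⊆ˢ A) (C ⊆ˢ D)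
    where
    head : ∀ c a d x y → ((not c ∨ a) ∧ x) ∧ ((not c ∨ d) ∧ y) ≡ (not c ∨ (a ∧ d)) ∧ (x ∧ y)
    head true  true  true  x y = refl
    head true  true  false x y = ∧-zeroʳ x
    head true  false d     x y = refl
    head false a     d     x y = refl

  alternating-sum : ∀ k (D : Subset k) →
    Σ (vecsFrom (true ∷ false ∷ []) k) (λ C → if C ⊆ˢ D then sign C else 0ℤ) ≡ iverson (isEmpty D)
  alternating-sum zero    []      = refl
  alternating-sum (suc k) (d ∷ D) = begin
    Σ (concatMap (λ x → map (x ∷_) Cs) (true ∷ false ∷ [])) f
      ≡⟨ Σ-concatMap (λ x → map (x ∷_) Cs) (true ∷ false ∷ []) f ⟩
    Σ (map (true ∷_) Cs) f ℤ.+ (Σ (map (false ∷_) Cs) f ℤ.+ 0ℤ)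
      ≡⟨ cong₂ (λ a b → a ℤ.+ (b ℤ.+ 0ℤ)) (Σ-map (true ∷_) Cs f) (Σ-map (false ∷_) Cs f) ⟩
    Σ Cs (λ C → f (true ∷ C)) ℤ.+ (Σ Cs (λ C → f (false ∷ C)) ℤ.+ 0ℤ)
      ≡⟨ cong (λ z → Σ Cs (λ C → f (true ∷ C)) ℤ.+ z) (ℤP.+-identityʳ _) ⟩
    Σ Cs (λ C → f (true ∷ C)) ℤ.+ Σ Cs (λ C → f (false ∷ C))
      ≡⟨ split d ⟩
    iverson (isEmpty (d ∷ D)) ∎
    where
    open ≡-Reasoning
    Cs : List (Subset k)
    Cs = vecsFrom (true ∷ false ∷ []) k
    f : Subset (suc k) → ℤ
    f C = if C ⊆ˢ (d ∷ D) then sign C else 0ℤ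
    g : Subset k → ℤ
    g C = if C ⊆ˢ D then sign C else 0ℤ
    split : ∀ d → Σ Cs (λ C → if (true ∷ C) ⊆ˢ (d ∷ D) then sign (true ∷ C) else 0ℤ)
                  ℤ.+ Σ Cs (λ C → if (false ∷ C) ⊆ˢ (d ∷ D) then sign (false ∷ C) else 0ℤ)
                ≡ iverson (isEmpty (d ∷ D))
    split true = begin
      Σ Cs (λ C → if C ⊆ˢ D then -1ℤ ℤ.* sign C else 0ℤ) ℤ.+ Σ Cs g
        ≡⟨ cong (ℤ._+ Σ Cs g) (trans (Σ-cong Cs (λ C → negate (C ⊆ˢ D) (sign C))) (Σ-*ˡ Cs -1ℤ g)) ⟩
      -1ℤ ℤ.* Σ Cs g ℤ.+ Σ Cs g
        ≡⟨ trans (cong (ℤ._+ Σ Cs g) (ℤP.-1*i≡-i (Σ Cs g))) (ℤP.+-inverseˡ (Σ Cs g)) ⟩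
      0ℤ ∎
      where
      negate : ∀ b x → (if b then -1ℤ ℤ.* x else 0ℤ) ≡ -1ℤ ℤ.* (if b then x else 0ℤ)
      negate true  x = refl
      negate false x = refl
    split false = trans (cong (ℤ._+ Σ Cs g) (Σ-zero Cs)) (trans (ℤP.+-identityˡ _) (alternating-sum k D))

module GeometricSum where

  open import Data.Nat using (ℕ; zero; suc; _+_; _*_; _∸_; _^_)
  open import Data.Nat.Properties using (*-zeroʳ; +-comm; [m+n]∸[m+o]≡n∸o; *-distribˡ-∸)
  open import Data.Nat.Tactic.RingSolver using (solve-∀)
  open import Relation.Binary.PropositionalEquality

  -- geometric p k = 1 + q + … + q ^ (k - 1) for q = suc p.
  geometric : ℕ → ℕ → ℕ
  geometric p zero    = 0
  geometric p (suc k) = suc p * geometric p k + 1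

  p*geometric+1≡q^ : ∀ p k → p * geometric p k + 1 ≡ suc p ^ k
  p*geometric+1≡q^ p zero    = cong (_+ 1) (*-zeroʳ p)
  p*geometric+1≡q^ p (suc k) = trans (step p (geometric p k)) (cong (suc p *_) (p*geometric+1≡q^ p k))
    where
    step : ∀ p g → p * (suc p * g + 1) + 1 ≡ suc p * (p * g + 1)
    step = solve-∀

  q^-difference : ∀ p a b → suc p ^ b ∸ suc p ^ a ≡ p * (geometric p b ∸ geometric p a)
  q^-difference p a b = begin
    suc p ^ b ∸ suc p ^ a                                     ≡⟨ cong₂ _∸_ (sym (p*geometric+1≡q^ p b)) (sym (p*geometric+1≡q^ p a)) ⟩
    (p * geometric p b + 1) ∸ (p * geometric p a + 1)         ≡⟨ cong₂ _∸_ (+-comm (p * geometric p b) 1) (+-comm (p * geometric p a) 1) ⟩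
    (1 + p * geometric p b) ∸ (1 + p * geometric p a)         ≡⟨ [m+n]∸[m+o]≡n∸o 1 (p * geometric p b) (p * geometric p a) ⟩
    p * geometric p b ∸ p * geometric p a                     ≡⟨ sym (*-distribˡ-∸ p (geometric p b) (geometric p a)) ⟩
    p * (geometric p b ∸ geometric p a)                       ∎
    where open ≡-Reasoning

module FieldVector {q : ℕ} (F : FiniteField q) where

  open import Data.Nat using (zero; suc)
  open import Data.Fin using (Fin)
  open import Data.Vec as V using (Vec; []; _∷_)
  open import Algebra.Bundles using (CommutativeRing)
  open import Algebra.Structures using (IsCommutativeRing)
  open import Relation.Binary.PropositionalEquality
  open FiniteField F public
    renaming (_+_ to infixl 6 _+_; _*_ to infixl 7 _*_; -_ to infix 8 -_; _⁻¹ to infix 9 _⁻¹)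
  open IsCommutativeRing isCommutativeRing public
    using (+-assoc; +-comm; +-identityˡ; +-identityʳ; *-assoc; *-comm; *-identityˡ; *-identityʳ; zeroˡ; zeroʳ;
           -‿inverseˡ; -‿inverseʳ; distribˡ; distribʳ)

  commutativeRing : CommutativeRing _ _
  commutativeRing = record { isCommutativeRing = isCommutativeRing }

  open import Algebra.Properties.Ring (CommutativeRing.ring commutativeRing) public
    using (-‿distribˡ-*; -‿distribʳ-*; -0#≈0#; -‿+-comm; -‿involutive; -1*x≈-x; x∙y⁻¹≈ε⇒x≈y)
  open import Algebra.Properties.CommutativeSemigroup
    (CommutativeRing.+-commutativeSemigroup commutativeRing) using (interchange)
  open ≡-Reasoning

  ⁻¹-inverseˡ : ∀ x → x ≢ 0# → x ⁻¹ * x ≡ 1#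
  ⁻¹-inverseˡ x x≢0 = trans (*-comm (x ⁻¹) x) (⁻¹-inverse x x≢0)

  infixl 6 _⊞_
  infixr 7 _⊙_
  infixl 6 _-[_]_

  _⊞_ : ∀ {m} → Vec (Fin q) m → Vec (Fin q) m → Vec (Fin q) m
  _⊞_ = V.zipWith _+_

  _⊙_ : ∀ {m} → Fin q → Vec (Fin q) m → Vec (Fin q) m
  c ⊙ v = V.map (c *_) v

  _-[_]_ : ∀ {m} → Vec (Fin q) m → Fin q → Vec (Fin q) m → Vec (Fin q) m
  u -[ c ] w = u ⊞ (- c) ⊙ w

  0ᵥ : ∀ m → Vec (Fin q) m
  0ᵥ m = V.replicate m 0#

  ⊞-identityˡ : ∀ {m} (v : Vec (Fin q) m) → 0ᵥ m ⊞ v ≡ v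
  ⊞-identityˡ []      = refl
  ⊞-identityˡ (x ∷ v) = cong₂ _∷_ (+-identityˡ x) (⊞-identityˡ v)

  ⊙-assoc : ∀ {m} c d (v : Vec (Fin q) m) → c ⊙ d ⊙ v ≡ (c * d) ⊙ v
  ⊙-assoc c d []      = refl
  ⊙-assoc c d (x ∷ v) = cong₂ _∷_ (sym (*-assoc c d x)) (⊙-assoc c d v)

  ⊙-identityˡ : ∀ {m} (v : Vec (Fin q) m) → 1# ⊙ v ≡ v
  ⊙-identityˡ []      = refl
  ⊙-identityˡ (x ∷ v) = cong₂ _∷_ (*-identityˡ x) (⊙-identityˡ v)

  ⊙-zeroʳ : ∀ {m} c → c ⊙ 0ᵥ m ≡ 0ᵥ m
  ⊙-zeroʳ {zero}  c = refl
  ⊙-zeroʳ {suc m} c = cong₂ _∷_ (zeroʳ c) (⊙-zeroʳ c)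

  -[0]-identityʳ : ∀ {m} (x w : Vec (Fin q) m) → x -[ 0# ] w ≡ x
  -[0]-identityʳ []       []       = refl
  -[0]-identityʳ (x ∷ xs) (w ∷ ws) = cong₂ _∷_ scalar (-[0]-identityʳ xs ws)
    where
    scalar : x + (- 0#) * w ≡ x
    scalar = trans (cong (λ z → x + z * w) -0#≈0#) (trans (cong (x +_) (zeroˡ w)) (+-identityʳ x))

  -[1]-inverseʳ : ∀ {m} (v : Vec (Fin q) m) → v -[ 1# ] v ≡ 0ᵥ m
  -[1]-inverseʳ []      = refl
  -[1]-inverseʳ (x ∷ v) = cong₂ _∷_ (trans (cong (x +_) (-1*x≈-x x)) (-‿inverseʳ x)) (-[1]-inverseʳ v)

  -[]-+-cancel : ∀ {m} c (u w : Vec (Fin q) m) → u -[ c ] w ⊞ c ⊙ w ≡ u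
  -[]-+-cancel c []      []      = refl
  -[]-+-cancel c (x ∷ u) (y ∷ w) = cong₂ _∷_ scalar (-[]-+-cancel c u w)
    where
    scalar : x + (- c) * y + c * y ≡ x
    scalar = begin
      x + (- c) * y + c * y     ≡⟨ cong (λ z → x + z + c * y) (sym (-‿distribˡ-* c y)) ⟩
      x + - (c * y) + c * y     ≡⟨ +-assoc x _ _ ⟩
      x + (- (c * y) + c * y)   ≡⟨ cong (x +_) (-‿inverseˡ (c * y)) ⟩
      x + 0#                    ≡⟨ +-identityʳ x ⟩
      x                         ∎

  +-[]-cancel : ∀ {m} c (u w : Vec (Fin q) m) → (u ⊞ c ⊙ w) -[ c ] w ≡ u
  +-[]-cancel c []      []      = refl
  +-[]-cancel c (x ∷ u) (y ∷ w) = cong₂ _∷_ scalar (+-[]-cancel c u w)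
    where
    scalar : x + c * y + (- c) * y ≡ x
    scalar = begin
      x + c * y + (- c) * y     ≡⟨ cong (x + c * y +_) (sym (-‿distribˡ-* c y)) ⟩
      x + c * y + - (c * y)     ≡⟨ +-assoc x _ _ ⟩
      x + (c * y + - (c * y))   ≡⟨ cong (x +_) (-‿inverseʳ (c * y)) ⟩
      x + 0#                    ≡⟨ +-identityʳ x ⟩
      x                         ∎

  ⊞-distrib-[] : ∀ {m} c d (x y w : Vec (Fin q) m) → (x ⊞ y) -[ c + d ] w ≡ (x -[ c ] w) ⊞ (y -[ d ] w)
  ⊞-distrib-[] c d []       []       []       = refl
  ⊞-distrib-[] c d (x ∷ xs) (y ∷ ys) (w ∷ ws) = cong₂ _∷_ scalar (⊞-distrib-[] c d xs ys ws)
    where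
    scalar : x + y + (- (c + d)) * w ≡ x + (- c) * w + (y + (- d) * w)
    scalar = begin
      x + y + (- (c + d)) * w        ≡⟨ cong (λ z → x + y + z * w) (sym (-‿+-comm c d)) ⟩
      x + y + ((- c) + (- d)) * w    ≡⟨ cong (x + y +_) (distribʳ w (- c) (- d)) ⟩
      x + y + ((- c) * w + (- d) * w) ≡⟨ interchange x y _ _ ⟩
      x + (- c) * w + (y + (- d) * w) ∎

  ⊙-distrib-[] : ∀ {m} k c (x w : Vec (Fin q) m) → k ⊙ x -[ k * c ] w ≡ k ⊙ (x -[ c ] w)
  ⊙-distrib-[] k c []       []       = refl
  ⊙-distrib-[] k c (x ∷ xs) (w ∷ ws) = cong₂ _∷_ scalar (⊙-distrib-[] k c xs ws)
    where
    scalar : k * x + (- (k * c)) * w ≡ k * (x + (- c) * w)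
    scalar = begin
      k * x + (- (k * c)) * w    ≡⟨ cong (λ z → k * x + z * w) (-‿distribʳ-* k c) ⟩
      k * x + (k * (- c)) * w    ≡⟨ cong (k * x +_) (*-assoc k (- c) w) ⟩
      k * x + k * ((- c) * w)    ≡⟨ sym (distribˡ k x _) ⟩
      k * (x + (- c) * w)        ∎

  -[]-difference : ∀ {m} c d (x w : Vec (Fin q) m) → x -[ c ] w -[ 1# ] (x -[ d ] w) ≡ (d + (- c)) ⊙ w
  -[]-difference c d []       []       = refl
  -[]-difference c d (x ∷ xs) (w ∷ ws) = cong₂ _∷_ scalar (-[]-difference c d xs ws)
    where
    scalar : x + (- c) * w + (- 1#) * (x + (- d) * w) ≡ (d + (- c)) * w
    scalar = begin
      x + (- c) * w + (- 1#) * (x + (- d) * w)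
        ≡⟨ cong (x + (- c) * w +_) (trans (-1*x≈-x _) (sym (-‿+-comm x _))) ⟩
      x + (- c) * w + ((- x) + - ((- d) * w))
        ≡⟨ cong (λ z → x + (- c) * w + ((- x) + z)) (trans (-‿distribˡ-* (- d) w) (cong (_* w) (-‿involutive d))) ⟩
      x + (- c) * w + ((- x) + d * w)
        ≡⟨ interchange x _ (- x) _ ⟩
      x + (- x) + ((- c) * w + d * w)
        ≡⟨ cong₂ _+_ (-‿inverseʳ x) (sym (distribʳ w (- c) d)) ⟩
      0# + ((- c) + d) * w
        ≡⟨ trans (+-identityˡ _) (cong (_* w) (+-comm (- c) d)) ⟩
      (d + (- c)) * w ∎

module Subspace {q : ℕ} (F : FiniteField q) (n : ℕ) where

  open ListSum
  open BoolLemmas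
  open Enumeration
  open VSetProperties
  open import Data.Integer as ℤ using (ℤ)
  open import Data.List using (allFin; length)
  open import Data.List.Properties using (length-tabulate)
  open import Data.Bool using (Bool; true; false; _∧_; _∨_; not)
  open import Data.Bool.Properties using (∧-conicalˡ; ∧-conicalʳ)
  open import Data.Bool.ListAction using (all; any)
  open import Data.Empty using (⊥-elim)
  open import Data.Product using (∃; _×_; _,_; proj₂)
  open import Data.List.Membership.Propositional using (_∈_)
  open import Data.List.Membership.Propositional.Properties using (∈-allFin)
  open import Data.Fin.Properties using () renaming (_≟_ to _≟ᶠ_)
  open import Relation.Nullary using (yes; no)
  open import Relation.Binary.PropositionalEquality

  open FieldVector F public
  open QMatroid F n public

  ∈-allV : ∀ v → v ∈ allV
  ∈-allV v = vecsFrom-∈ ∈-allFin v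

  eqVect : Vect → Vect → Bool
  eqVect = eqVec eqFin

  allV-enumeration : IsEnumeration eqVect allV
  allV-enumeration = vecsFrom-enumeration (fin-enumeration q) n

  all-allV : (p : Vect → Bool) → all p allV ≡ true → ∀ v → p v ≡ true
  all-allV p h v = all-sound p h (∈-allV v)

  all-allV-complete : (p : Vect → Bool) → (∀ v → p v ≡ true) → all p allV ≡ true
  all-allV-complete p h = all-complete p allV (λ v _ → h v)

  infix 4 _∈ₛ_ _⊆ₛ_

  _∈ₛ_ : Vect → Sets → Set
  v ∈ₛ A = v ∈ᵇ A ≡ true

  _⊆ₛ_ : Sets → Sets → Set
  A ⊆ₛ B = ∀ v → v ∈ₛ A → v ∈ₛ B

  ⊆ᵇ⇒⊆ : ∀ A B → A ⊆ᵇ B ≡ true → A ⊆ₛ B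
  ⊆ᵇ⇒⊆ A B A⊆B v v∈A = ⇒ᵇ-elim (all-allV _ A⊆B v) v∈A

  ⊆⇒⊆ᵇ : ∀ A B → A ⊆ₛ B → A ⊆ᵇ B ≡ true
  ⊆⇒⊆ᵇ A B A⊆B = all-allV-complete _ (λ v → ⇒ᵇ-intro (A⊆B v))

  ⊆ᵇ-refl : ∀ A → A ⊆ᵇ A ≡ true
  ⊆ᵇ-refl A = ⊆⇒⊆ᵇ A A (λ _ v∈A → v∈A)

  ⊆ᵇ-false⇒∃ : ∀ A B → A ⊆ᵇ B ≡ false → ∃ λ v → v ∈ₛ A × v ∈ᵇ B ≡ false
  ⊆ᵇ-false⇒∃ A B A⊈B with all-false⇒∃ _ allV A⊈B
  ... | v , _ , _ with v ∈ᵇ A in v∈A | v ∈ᵇ B in v∉B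
  ...   | true | false = v , v∈A , v∉B

  ⊆-antisym : ∀ A B → A ⊆ₛ B → B ⊆ₛ A → A ≡ B
  ⊆-antisym A B A⊆B B⊆A = VSet-ext A B (λ v → ⇔-true⇒≡ (A⊆B v) (B⊆A v))

  IsSubspace : Sets → Set
  IsSubspace U = isSubspace U ≡ true

  module _ {U : Sets} (U-sub : IsSubspace U) where

    private
      ⊞-closedᵇ ⊙-closedᵇ : Bool
      ⊞-closedᵇ = all (λ u → all (λ v → not ((u ∈ᵇ U) ∧ (v ∈ᵇ U)) ∨ ((u ⊞ v) ∈ᵇ U)) allV) allV
      ⊙-closedᵇ = all (λ c → all (λ v → not (v ∈ᵇ U) ∨ ((c ⊙ v) ∈ᵇ U)) allV) (allFin q)

    0∈ : 0v ∈ₛ U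
    0∈ = ∧-conicalˡ (0v ∈ᵇ U) _ U-sub

    ⊞-closed : ∀ {u v} → u ∈ₛ U → v ∈ₛ U → u ⊞ v ∈ₛ U
    ⊞-closed {u} {v} u∈U v∈U =
      ⇒ᵇ-elim (all-allV _ (all-allV _ (∧-conicalˡ ⊞-closedᵇ ⊙-closedᵇ (∧-conicalʳ (0v ∈ᵇ U) _ U-sub)) u) v)
              (cong₂ _∧_ u∈U v∈U)

    ⊙-closed : ∀ c {v} → v ∈ₛ U → c ⊙ v ∈ₛ U
    ⊙-closed c {v} v∈U =
      ⇒ᵇ-elim (all-allV _ (all-sound (λ c → all (λ v → not (v ∈ᵇ U) ∨ ((c ⊙ v) ∈ᵇ U)) allV)
                                     (∧-conicalʳ ⊞-closedᵇ ⊙-closedᵇ (∧-conicalʳ (0v ∈ᵇ U) _ U-sub)) (∈-allFin c)) v)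
              v∈U

    -[]-closed : ∀ {u v} c → u ∈ₛ U → v ∈ₛ U → u -[ c ] v ∈ₛ U
    -[]-closed c u∈U v∈U = ⊞-closed u∈U (⊙-closed (- c) v∈U)

  isSubspace-intro : ∀ {U} → 0v ∈ₛ U → (∀ u v → u ∈ₛ U → v ∈ₛ U → u ⊞ v ∈ₛ U) →
                     (∀ c v → v ∈ₛ U → c ⊙ v ∈ₛ U) → IsSubspace U
  isSubspace-intro 0∈U ⊞∈U ⊙∈U =
    cong₂ _∧_ 0∈U (cong₂ _∧_ (all-allV-complete _ (λ u → all-allV-complete _ (λ v →
                                 ⇒ᵇ-intro (λ uv∈U → ⊞∈U u v (∧-conicalˡ _ _ uv∈U) (∧-conicalʳ _ _ uv∈U)))))
                             (all-complete _ (allFin q) (λ c _ → all-allV-complete _ (λ v → ⇒ᵇ-intro (⊙∈U c v)))))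

  ∈-subspaces : ∀ {U} → IsSubspace U → U ∈ subspaces
  ∈-subspaces {U} U-sub = ∈-filterᵇ⁺ isSubspace (∈-allSets q n U) U-sub

  ∈-subspaces⁻ : ∀ {U} → U ∈ subspaces → IsSubspace U
  ∈-subspaces⁻ U∈ = proj₂ (∈-filterᵇ⁻ isSubspace {allSets q n} U∈)

  module _ (P : Vect → Bool) where

    private
      span-intro : ∀ v → (∀ W → IsSubspace W → (∀ u → P u ≡ true → u ∈ₛ W) → v ∈ₛ W) → v ∈ₛ span P
      span-intro v h = trans (∈ᵇ-tabulateSet _ v) (all-complete _ subspaces (λ W W∈ → ⇒ᵇ-intro (λ P⊆W →
        h W (∈-subspaces⁻ W∈) (λ u Pu → ⇒ᵇ-elim (all-allV _ P⊆W u) Pu))))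

    span-least : ∀ W → IsSubspace W → (∀ u → P u ≡ true → u ∈ₛ W) → span P ⊆ₛ W
    span-least W W-sub P⊆W v v∈span =
      ⇒ᵇ-elim (all-sound _ (trans (sym (∈ᵇ-tabulateSet _ v)) v∈span) (∈-subspaces W-sub))
              (all-allV-complete _ (λ u → ⇒ᵇ-intro (P⊆W u)))

    span-isSubspace : IsSubspace (span P)
    span-isSubspace = isSubspace-intro
      (span-intro 0v (λ W W-sub _ → 0∈ W-sub))
      (λ u v u∈ v∈ → span-intro _ (λ W W-sub P⊆W →
         ⊞-closed W-sub (span-least W W-sub P⊆W u u∈) (span-least W W-sub P⊆W v v∈)))
      (λ c v v∈ → span-intro _ (λ W W-sub P⊆W → ⊙-closed W-sub c (span-least W W-sub P⊆W v v∈)))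

    ⊆-span : ∀ v → P v ≡ true → v ∈ₛ span P
    ⊆-span v Pv = span-intro v (λ W _ P⊆W → P⊆W v Pv)

  cardℤ : Sets → ℤ
  cardℤ A = Σ allV (λ v → iverson (v ∈ᵇ A))

  card≡cardℤ : ∀ A → ℤ.+ card A ≡ cardℤ A
  card≡cardℤ A = length-filterᵇ-Σ (_∈ᵇ A) allV

  -- adjoin Z v is the subspace Z + ⟨v⟩ = { x | x - c v ∈ Z for some scalar c }.
  adjoin : Sets → Vect → Sets
  adjoin Z v = tabulateSet (λ x → any (λ c → (x -[ c ] v) ∈ᵇ Z) (allFin q))

  module _ (Z : Sets) (v : Vect) where

    ∈-adjoin⁺ : ∀ x c → x -[ c ] v ∈ₛ Z → x ∈ₛ adjoin Z v
    ∈-adjoin⁺ x c x-cv∈Z =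
      trans (∈ᵇ-tabulateSet _ x) (any-complete (λ c → (x -[ c ] v) ∈ᵇ Z) (∈-allFin c) x-cv∈Z)

    ∈-adjoin⁻ : ∀ x → x ∈ₛ adjoin Z v → ∃ λ c → x -[ c ] v ∈ₛ Z
    ∈-adjoin⁻ x x∈ with any-sound (λ c → (x -[ c ] v) ∈ᵇ Z) (allFin q) (trans (sym (∈ᵇ-tabulateSet _ x)) x∈)
    ... | c , _ , x-cv∈Z = c , x-cv∈Z

    module _ (Z-sub : IsSubspace Z) where

      adjoin-isSubspace : IsSubspace (adjoin Z v)
      adjoin-isSubspace = isSubspace-intro
        (∈-adjoin⁺ 0v 0# (subst (_∈ₛ Z) (sym (-[0]-identityʳ 0v v)) (0∈ Z-sub)))
        (λ x y x∈ y∈ → let (c , x-cv∈Z) = ∈-adjoin⁻ x x∈ ; (d , y-dv∈Z) = ∈-adjoin⁻ y y∈ in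
           ∈-adjoin⁺ (x ⊞ y) (c + d) (subst (_∈ₛ Z) (sym (⊞-distrib-[] c d x y v)) (⊞-closed Z-sub x-cv∈Z y-dv∈Z)))
        (λ k x x∈ → let (c , x-cv∈Z) = ∈-adjoin⁻ x x∈ in
           ∈-adjoin⁺ (k ⊙ x) (k * c) (subst (_∈ₛ Z) (sym (⊙-distrib-[] k c x v)) (⊙-closed Z-sub k x-cv∈Z)))

      ∈-adjoin-new : v ∈ₛ adjoin Z v
      ∈-adjoin-new = ∈-adjoin⁺ v 1# (subst (_∈ₛ Z) (sym (-[1]-inverseʳ v)) (0∈ Z-sub))

      adjoin-least : ∀ W → IsSubspace W → Z ⊆ₛ W → v ∈ₛ W → adjoin Z v ⊆ₛ W
      adjoin-least W W-sub Z⊆W v∈W x x∈ with ∈-adjoin⁻ x x∈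
      ... | c , x-cv∈Z = subst (_∈ₛ W) (-[]-+-cancel c x v) (⊞-closed W-sub (Z⊆W _ x-cv∈Z) (⊙-closed W-sub c v∈W))

      -- When v ∉ Z the scalar c in x - c v ∈ Z is unique, so x ↦ x - c v is a
      -- bijection from adjoin Z v onto q disjoint translates of Z.
      cardℤ-adjoin : v ∈ᵇ Z ≡ false → cardℤ (adjoin Z v) ≡ ℤ.+ q ℤ.* cardℤ Z
      cardℤ-adjoin v∉Z = begin
        cardℤ (adjoin Z v)
          ≡⟨ Σ-cong allV (λ x → cong iverson (∈ᵇ-tabulateSet _ x)) ⟩
        Σ allV (λ x → iverson (any (λ c → (x -[ c ] v) ∈ᵇ Z) (allFin q)))
          ≡⟨ Σ-cong allV (λ x → IsEnumeration.iverson-any (fin-enumeration q) _ (scalar-unique x)) ⟩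
        Σ allV (λ x → Σ (allFin q) (λ c → iverson ((x -[ c ] v) ∈ᵇ Z)))
          ≡⟨ Σ-swap allV (allFin q) _ ⟩
        Σ (allFin q) (λ c → Σ allV (λ x → iverson ((x -[ c ] v) ∈ᵇ Z)))
          ≡⟨ Σ-cong (allFin q) (λ c → IsEnumeration.Σ-reindex allV-enumeration (λ x → x -[ c ] v) (λ x → x ⊞ c ⊙ v)
                                        (λ x → -[]-+-cancel c x v) (λ x → +-[]-cancel c x v) (λ x → iverson (x ∈ᵇ Z))) ⟩
        Σ (allFin q) (λ _ → cardℤ Z)
          ≡⟨ Σ-const (allFin q) (cardℤ Z) ⟩
        ℤ.+ length (allFin q) ℤ.* cardℤ Z
          ≡⟨ cong (λ k → ℤ.+ k ℤ.* cardℤ Z) (length-tabulate {n = q} (λ i → i)) ⟩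
        ℤ.+ q ℤ.* cardℤ Z ∎
        where
        open ≡-Reasoning
        scalar-unique : ∀ x c d → x -[ c ] v ∈ₛ Z → x -[ d ] v ∈ₛ Z → c ≡ d
        scalar-unique x c d x-cv∈Z x-dv∈Z with d + (- c) ≟ᶠ 0#
        ... | yes d-c≡0 = sym (x∙y⁻¹≈ε⇒x≈y d c d-c≡0)
        ... | no d-c≢0  = ⊥-elim (true≢false (trans (sym v∈Z) v∉Z))
          where
          [d-c]v∈Z : (d + (- c)) ⊙ v ∈ₛ Z
          [d-c]v∈Z = subst (_∈ₛ Z) (-[]-difference c d x v) (-[]-closed Z-sub 1# x-cv∈Z x-dv∈Z)
          v∈Z : v ∈ₛ Z
          v∈Z = subst (_∈ₛ Z) (trans (⊙-assoc _ _ v) (trans (cong (_⊙ v) (⁻¹-inverseˡ _ d-c≢0)) (⊙-identityˡ v)))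
                      (⊙-closed Z-sub ((d + (- c)) ⁻¹) [d-c]v∈Z)

module Dimension {q : ℕ} (F : FiniteField q) (n : ℕ) where

  open BoolLemmas
  open Enumeration
  open VSetProperties
  open import Data.Nat as ℕ using (zero; suc; _≤_; _<_; _^_; z≤n; s≤s; NonZero)
  open import Data.Nat.Properties as ℕP using ()
  open import Data.Integer.Properties as ℤP using ()
  open import Data.Integer as ℤ using ()
  open import Data.List using ([]; _∷_; filterᵇ; length; allFin; applyUpTo)
  open import Data.List.Properties using (length-tabulate; length-filter)
  open import Data.Bool using (Bool; true; false)
  open import Data.Bool.Properties using (T-≡)
  open import Data.Empty using (⊥-elim)
  open import Data.Product using (∃; _×_; _,_)
  open import Data.Sum using (inj₁; inj₂)
  open import Function using (_∘_)
  open import Function.Bundles using (Equivalence)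
  open import Relation.Binary.PropositionalEquality
  open import Relation.Nullary using (yes; no)
  open import Data.Vec.Properties using (≡-dec)
  open import Data.Fin.Properties using () renaming (_≟_ to _≟ᶠ_)
  open ListSum

  open Subspace F n public

  module _ (m : ℕ) (1<m : 1 < m) where

    ^-cancelˡ-≤ : ∀ {a b} → m ^ a ≤ m ^ b → a ≤ b
    ^-cancelˡ-≤ {a} {b} mᵃ≤mᵇ with ℕP.≤-<-connex a b
    ... | inj₁ a≤b = a≤b
    ... | inj₂ b<a = ⊥-elim (ℕP.<⇒≱ (ℕP.^-monoʳ-< m 1<m b<a) mᵃ≤mᵇ)

    ^-injectiveʳ : ∀ {a b} → m ^ a ≡ m ^ b → a ≡ b
    ^-injectiveʳ {a} {b} mᵃ≡mᵇ =
      ℕP.≤-antisym (^-cancelˡ-≤ (ℕP.≤-reflexive mᵃ≡mᵇ)) (^-cancelˡ-≤ (ℕP.≤-reflexive (sym mᵃ≡mᵇ)))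

  2≤q : 2 ≤ q
  2≤q = from-nonZero q (qm1-nonZero F)
    where
    from-nonZero : ∀ q → NonZero (q ℕ.∸ 1) → 2 ≤ q
    from-nonZero (suc (suc _)) _ = s≤s (s≤s z≤n)

  instance
    q-nonZero : NonZero q
    q-nonZero = ℕ.>-nonZero (ℕP.<-trans (s≤s z≤n) 2≤q)

  length-allV : length allV ≡ q ^ n
  length-allV = trans (length-vecsFrom (allFin q) n) (cong (_^ n) (length-tabulate {n = q} (λ i → i)))

  card≤q^n : ∀ A → card A ≤ q ^ n
  card≤q^n A = subst (card A ≤_) length-allV (length-filter _ allV)

  ∈-E : ∀ v → v ∈ₛ E
  ∈-E v = ∈ᵇ-tabulateSet {q} {n} (λ _ → true) v

  card-E : card E ≡ q ^ n
  card-E = trans (cong length (filter-all allV)) length-allV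
    where
    filter-all : ∀ xs → filterᵇ (_∈ᵇ E) xs ≡ xs
    filter-all []       = refl
    filter-all (x ∷ xs) rewrite ∈-E x = cong (x ∷_) (filter-all xs)

  card-mono : ∀ A B → A ⊆ₛ B → card A ≤ card B
  card-mono A B A⊆B = length-filterᵇ-mono _ _ A⊆B allV

  card-pos : ∀ U → IsSubspace U → 1 ≤ card U
  card-pos U U-sub = length-filterᵇ-pos (_∈ᵇ U) (∈-allV 0v) (0∈ U-sub)

  card-adjoin : ∀ Z v → IsSubspace Z → v ∈ᵇ Z ≡ false → card (adjoin Z v) ≡ q ℕ.* card Z
  card-adjoin Z v Z-sub v∉Z = ℤP.+-injective (begin
    ℤ.+ card (adjoin Z v)   ≡⟨ card≡cardℤ _ ⟩
    cardℤ (adjoin Z v)      ≡⟨ cardℤ-adjoin Z v Z-sub v∉Z ⟩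
    ℤ.+ q ℤ.* cardℤ Z       ≡⟨ cong (ℤ.+ q ℤ.*_) (sym (card≡cardℤ Z)) ⟩
    ℤ.+ q ℤ.* ℤ.+ card Z    ≡⟨ sym (ℤP.pos-* q (card Z)) ⟩
    ℤ.+ (q ℕ.* card Z)      ∎)
    where
    open ≡-Reasoning

  ==≡eqVect : ∀ (u v : Vect) → (u == v) ≡ eqVect u v
  ==≡eqVect u v with ≡-dec _≟ᶠ_ u v | eqVect u v in u≟v
  ... | yes _    | true  = refl
  ... | no  _    | false = refl
  ... | yes refl | false = ⊥-elim (true≢false (trans (sym (IsEnumeration.complete allV-enumeration u)) u≟v))
  ... | no u≢v   | true  = ⊥-elim (u≢v (IsEnumeration.sound allV-enumeration u v u≟v))

  ∈ᵇ-zeroS : ∀ v → v ∈ᵇ zeroS ≡ eqVect v 0v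
  ∈ᵇ-zeroS v = trans (∈ᵇ-tabulateSet (_== 0v) v) (==≡eqVect v 0v)

  card-zeroS : card zeroS ≡ 1
  card-zeroS = ℤP.+-injective (trans (card≡cardℤ zeroS)
    (trans (Σ-cong allV (λ x → cong iverson (∈ᵇ-zeroS x))) (IsEnumeration.Σ-single allV-enumeration 0v ℤ.1ℤ)))

  ∈-zeroS⁻ : ∀ u → u ∈ₛ zeroS → u ≡ 0v
  ∈-zeroS⁻ u u∈ = IsEnumeration.sound allV-enumeration u 0v (trans (sym (∈ᵇ-zeroS u)) u∈)

  ∈-zeroS⁺ : ∀ u → u ≡ 0v → u ∈ₛ zeroS
  ∈-zeroS⁺ u refl = trans (∈ᵇ-zeroS 0v) (IsEnumeration.complete allV-enumeration 0v)

  zeroS-isSubspace : IsSubspace zeroS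
  zeroS-isSubspace = isSubspace-intro (∈-zeroS⁺ 0v refl)
    (λ u v u∈ v∈ → ∈-zeroS⁺ _ (trans (cong₂ _⊞_ (∈-zeroS⁻ u u∈) (∈-zeroS⁻ v v∈)) (⊞-identityˡ (0ᵥ n))))
    (λ c v v∈ → ∈-zeroS⁺ _ (trans (cong (c ⊙_) (∈-zeroS⁻ v v∈)) (⊙-zeroʳ c)))

  zeroS-least : ∀ U → IsSubspace U → zeroS ⊆ₛ U
  zeroS-least U U-sub u u∈ = subst (_∈ₛ U) (sym (∈-zeroS⁻ u u∈)) (0∈ U-sub)

  E-isSubspace : IsSubspace E
  E-isSubspace = isSubspace-intro (∈-E 0v) (λ u v _ _ → ∈-E (u ⊞ v)) (λ c v _ → ∈-E (c ⊙ v))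

  E-greatest : ∀ U → U ⊆ₛ E
  E-greatest U v _ = ∈-E v

  q*card≤card : ∀ Z W v → IsSubspace Z → IsSubspace W → Z ⊆ₛ W → v ∈ₛ W → v ∈ᵇ Z ≡ false →
                q ℕ.* card Z ≤ card W
  q*card≤card Z W v Z-sub W-sub Z⊆W v∈W v∉Z =
    subst (_≤ card W) (card-adjoin Z v Z-sub v∉Z) (card-mono _ _ (adjoin-least Z v Z-sub W W-sub Z⊆W v∈W))

  card<q*card : ∀ Z → IsSubspace Z → card Z < q ℕ.* card Z
  card<q*card Z Z-sub =
    subst (ℕ._< q ℕ.* card Z) (ℕP.*-identityˡ (card Z)) (ℕP.*-monoˡ-< (card Z) {{ℕ.>-nonZero (card-pos Z Z-sub)}} 2≤q)

  card<card : ∀ Z W v → IsSubspace Z → IsSubspace W → Z ⊆ₛ W → v ∈ₛ W → v ∈ᵇ Z ≡ false → card Z < card W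
  card<card Z W v Z-sub W-sub Z⊆W v∈W v∉Z =
    ℕP.<-≤-trans (card<q*card Z Z-sub) (q*card≤card Z W v Z-sub W-sub Z⊆W v∈W v∉Z)

  subspace-⊆-card-≤⇒≡ : ∀ Z W → IsSubspace Z → IsSubspace W → Z ⊆ₛ W → card W ≤ card Z → Z ≡ W
  subspace-⊆-card-≤⇒≡ Z W Z-sub W-sub Z⊆W W≤Z with W ⊆ᵇ Z in W⊆Z
  ... | true = ⊆-antisym Z W Z⊆W (⊆ᵇ⇒⊆ W Z W⊆Z)
  ... | false with ⊆ᵇ-false⇒∃ W Z W⊆Z
  ...   | v , v∈W , v∉Z = ⊥-elim (ℕP.<⇒≱ (card<card Z W v Z-sub W-sub Z⊆W v∈W v∉Z) W≤Z)

  -- Any subspace U ⊇ Z is reached from Z by adjoining d vectors one at a time, each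
  -- step multiplying the cardinality by q; a quantity g that drops by at most a factor
  -- q per step then satisfies g Z ≤ q ^ d * g U.
  module Growth (g : Sets → ℕ) (g-step : ∀ Z v → IsSubspace Z → v ∈ᵇ Z ≡ false → g Z ≤ q ℕ.* g (adjoin Z v)) where

    private
      grow-fuel : ∀ fuel Z U → IsSubspace Z → IsSubspace U → Z ⊆ₛ U → card U ℕ.∸ card Z < fuel →
                  ∃ λ d → card U ≡ q ^ d ℕ.* card Z × g Z ≤ q ^ d ℕ.* g U
      grow-fuel fuel Z U Z-sub U-sub Z⊆U _ with U ⊆ᵇ Z in U⊆Z
      ... | true with ⊆-antisym U Z (⊆ᵇ⇒⊆ U Z U⊆Z) Z⊆U
      ...   | refl = 0 , sym (ℕP.*-identityˡ (card U)) , ℕP.≤-reflexive (sym (ℕP.*-identityˡ (g U)))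
      grow-fuel (suc fuel) Z U Z-sub U-sub Z⊆U gap | false with ⊆ᵇ-false⇒∃ U Z U⊆Z
      ... | v , v∈U , v∉Z with grow-fuel fuel (adjoin Z v) U (adjoin-isSubspace Z v Z-sub) U-sub Z+v⊆U gap′
        where
        Z+v⊆U : adjoin Z v ⊆ₛ U
        Z+v⊆U = adjoin-least Z v Z-sub U U-sub Z⊆U v∈U
        gap′ : card U ℕ.∸ card (adjoin Z v) < fuel
        gap′ = ℕP.<-≤-trans (ℕP.∸-monoʳ-< (subst (card Z <_) (sym (card-adjoin Z v Z-sub v∉Z)) (card<q*card Z Z-sub))
                                           (card-mono _ _ Z+v⊆U))
                            (ℕP.≤-pred gap)
      ... | d , card-U , g-bound = suc d , card-U′ , g-bound′
        where
        open ≡-Reasoning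
        card-U′ : card U ≡ q ^ suc d ℕ.* card Z
        card-U′ = begin
          card U                        ≡⟨ card-U ⟩
          q ^ d ℕ.* card (adjoin Z v)   ≡⟨ cong (q ^ d ℕ.*_) (card-adjoin Z v Z-sub v∉Z) ⟩
          q ^ d ℕ.* (q ℕ.* card Z)      ≡⟨ sym (ℕP.*-assoc (q ^ d) q (card Z)) ⟩
          q ^ d ℕ.* q ℕ.* card Z        ≡⟨ cong (ℕ._* card Z) (ℕP.*-comm (q ^ d) q) ⟩
          q ^ suc d ℕ.* card Z          ∎
        g-bound′ : g Z ≤ q ^ suc d ℕ.* g U
        g-bound′ = ℕP.≤-trans (g-step Z v Z-sub v∉Z)
                     (ℕP.≤-trans (ℕP.*-monoʳ-≤ q g-bound) (ℕP.≤-reflexive (sym (ℕP.*-assoc q (q ^ d) (g U)))))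

    grow : ∀ Z U → IsSubspace Z → IsSubspace U → Z ⊆ₛ U → ∃ λ d → card U ≡ q ^ d ℕ.* card Z × g Z ≤ q ^ d ℕ.* g U
    grow Z U Z-sub U-sub Z⊆U = grow-fuel (suc (card U)) Z U Z-sub U-sub Z⊆U (s≤s (ℕP.m∸n≤m (card U) (card Z)))

  card≡q^ : ∀ U → IsSubspace U → ∃ λ d → card U ≡ q ^ d × d ≤ n
  card≡q^ U U-sub with Growth.grow (λ _ → 0) (λ _ _ _ _ → z≤n) zeroS U zeroS-isSubspace U-sub (zeroS-least U U-sub)
  ... | d , card-U , _ = d , card-U′ , ^-cancelˡ-≤ q 2≤q (subst (ℕ._≤ q ^ n) card-U′ (card≤q^n U))
    where
    card-U′ : card U ≡ q ^ d
    card-U′ = trans card-U (trans (cong (q ^ d ℕ.*_) card-zeroS) (ℕP.*-identityʳ _))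

  -- dim A counts the k ∈ {1, …, n} with q ^ k ≤ card A; when card A = q ^ d these are k = 1, …, d.
  dim-q^ : ∀ A d → card A ≡ q ^ d → d ≤ n → dim A ≡ d
  dim-q^ A d card-A d≤n rewrite card-A = count _ n d suc (λ i → q^1+i≤q^d⇔i<d i) d≤n
    where
    q^1+i≤q^d⇔i<d : ∀ i → (q ^ suc i ℕ.≤ᵇ q ^ d) ≡ (i ℕ.<ᵇ d)
    q^1+i≤q^d⇔i<d i = ⇔-true⇒≡
      (λ le → Equivalence.to T-≡ (ℕP.≤⇒≤ᵇ (^-cancelˡ-≤ q 2≤q {suc i} {d} (ℕP.≤ᵇ⇒≤ (q ^ suc i) (q ^ d) (Equivalence.from T-≡ le)))))
      (λ lt → Equivalence.to T-≡ (ℕP.≤⇒≤ᵇ (ℕP.^-monoʳ-≤ q {suc i} {d} (ℕP.≤ᵇ⇒≤ (suc i) d (Equivalence.from T-≡ lt)))))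
    count : ∀ (p : ℕ → Bool) m e (f : ℕ → ℕ) → (∀ i → p (f i) ≡ (i ℕ.<ᵇ e)) → e ≤ m →
            length (filterᵇ p (applyUpTo f m)) ≡ e
    count p zero    .zero   f p∘f≡ z≤n = refl
    count p (suc m) zero    f p∘f≡ _ rewrite p∘f≡ 0 = count p m zero (f ∘ suc) (p∘f≡ ∘ suc) z≤n
    count p (suc m) (suc e) f p∘f≡ (s≤s e≤m) rewrite p∘f≡ 0 = cong suc (count p m e (f ∘ suc) (p∘f≡ ∘ suc) e≤m)

  card≡q^dim : ∀ U → IsSubspace U → card U ≡ q ^ dim U
  card≡q^dim U U-sub with card≡q^ U U-sub
  ... | d , card-U , d≤n = trans card-U (cong (q ^_) (sym (dim-q^ U d card-U d≤n)))

  dim≤n : ∀ U → IsSubspace U → dim U ≤ n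
  dim≤n U U-sub with card≡q^ U U-sub
  ... | d , card-U , d≤n = subst (_≤ n) (sym (dim-q^ U d card-U d≤n)) d≤n

module Lines {q : ℕ} (F : FiniteField q) (n : ℕ) where

  open BoolLemmas
  open ListSum
  open Enumeration
  open IndexSubset
  open import Data.Nat as ℕ using (_≤_; _^_)
  open import Data.Nat.Properties as ℕP using ()
  open import Data.Integer using (ℤ)
  open import Data.List as L using (map; allFin)
  open import Data.List.Properties as ListP using ()
  open import Data.Vec as V using ()
  open import Data.Vec.Properties as VecP using ()
  open import Data.Fin using (Fin)
  open import Data.Fin.Subset using (Subset; ⊤)
  open VSetProperties using (lookup-ext)
  open import Data.Bool using (true; false; _∧_)
  open import Data.Bool.Properties using (∧-conicalˡ; ∧-conicalʳ)
  open import Data.Empty using (⊥-elim)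
  open import Data.Product using (_×_; _,_; proj₁; proj₂)
  open import Data.List.Membership.Propositional using (_∈_)
  open import Data.List.Membership.Propositional.Properties using (∈-allFin; ∈-lookup)
  open import Data.List.Relation.Unary.Any as Any using ()
  open import Data.List.Relation.Unary.Any.Properties using (lookup-index)
  open import Relation.Nullary using (yes; no)
  open import Relation.Binary.PropositionalEquality

  open Dimension F n public

  IsNonzero : Vect → Set
  IsNonzero v = v ∈ᵇ zeroS ≡ false

  line : Vect → Sets
  line v = adjoin zeroS v

  line-isSubspace : ∀ v → IsSubspace (line v)
  line-isSubspace v = adjoin-isSubspace zeroS v zeroS-isSubspace

  ∈-line : ∀ v → v ∈ₛ line v
  ∈-line v = ∈-adjoin-new zeroS v zeroS-isSubspace

  line-least : ∀ v U → IsSubspace U → v ∈ₛ U → line v ⊆ₛ U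
  line-least v U U-sub v∈U = adjoin-least zeroS v zeroS-isSubspace U U-sub (zeroS-least U U-sub) v∈U

  card-line : ∀ v → IsNonzero v → card (line v) ≡ q
  card-line v v≢0 = trans (card-adjoin zeroS v zeroS-isSubspace v≢0) (trans (cong (q ℕ.*_) card-zeroS) (ℕP.*-identityʳ q))

  dim≡1⇒card≡q : ∀ L → IsSubspace L → (dim L ℕ.≡ᵇ 1) ≡ true → card L ≡ q
  dim≡1⇒card≡q L L-sub dim≡1 = trans (card≡q^dim L L-sub) (trans (cong (q ^_) (≡ᵇ⇒≡ (dim L) 1 dim≡1)) (ℕP.*-identityʳ q))

  card≡q⇒dim≡1 : ∀ L → IsSubspace L → card L ≡ q → (dim L ℕ.≡ᵇ 1) ≡ true
  card≡q⇒dim≡1 L L-sub card-L = ≡⇒≡ᵇ _ _ (dim-q^ L 1 (trans card-L (sym (ℕP.*-identityʳ q))) 1≤n)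
    where
    1≤n : 1 ≤ n
    1≤n with n ℕ.≟ 0
    ... | no n≢0  = ℕP.n≢0⇒n>0 n≢0
    ... | yes n≡0 = ⊥-elim (ℕP.<⇒≱ (ℕP.≤-trans 2≤q (ℕP.≤-reflexive (sym card-L)))
                                   (subst (card L ≤_) (cong (q ^_) n≡0) (card≤q^n L)))

  ∈-lines⁺ : ∀ L → IsSubspace L → card L ≡ q → L ∈ lines
  ∈-lines⁺ L L-sub card-L = ∈-filterᵇ⁺ (λ W → dim W ℕ.≡ᵇ 1) (∈-subspaces L-sub) (card≡q⇒dim≡1 L L-sub card-L)

  ∈-lines⁻ : ∀ {L} → L ∈ lines → IsSubspace L × card L ≡ q
  ∈-lines⁻ {L} L∈ with ∈-filterᵇ⁻ (λ W → dim W ℕ.≡ᵇ 1) {subspaces} L∈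
  ... | L∈subspaces , dim≡1 = L-sub , dim≡1⇒card≡q L L-sub dim≡1
    where L-sub = ∈-subspaces⁻ L∈subspaces

  line-∈-lines : ∀ v → IsNonzero v → line v ∈ lines
  line-∈-lines v v≢0 = ∈-lines⁺ _ (line-isSubspace v) (card-line v v≢0)

  line≡ : ∀ {L} → L ∈ lines → ∀ v → v ∈ₛ L → IsNonzero v → line v ≡ L
  line≡ {L} L∈ v v∈L v≢0 with ∈-lines⁻ L∈
  ... | L-sub , card-L = subspace-⊆-card-≤⇒≡ _ L (line-isSubspace v) L-sub (line-least v L L-sub v∈L)
                           (ℕP.≤-reflexive (trans card-L (sym (card-line v v≢0))))

  m : ℕ
  m = #lines

  ℓ : Fin m → Sets
  ℓ i = L.lookup lines i

  ℓ-isSubspace : ∀ i → IsSubspace (ℓ i)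
  ℓ-isSubspace i = proj₁ (∈-lines⁻ (∈-lookup i))

  card-ℓ : ∀ i → card (ℓ i) ≡ q
  card-ℓ i = proj₂ (∈-lines⁻ (∈-lookup i))

  lineIndex : ∀ v → IsNonzero v → Fin m
  lineIndex v v≢0 = Any.index (line-∈-lines v v≢0)

  ℓ-lineIndex : ∀ v v≢0 → ℓ (lineIndex v v≢0) ≡ line v
  ℓ-lineIndex v v≢0 = sym (lookup-index (line-∈-lines v v≢0))

  ∈-ℓ-lineIndex : ∀ v v≢0 → v ∈ₛ ℓ (lineIndex v v≢0)
  ∈-ℓ-lineIndex v v≢0 = subst (v ∈ₛ_) (sym (ℓ-lineIndex v v≢0)) (∈-line v)

  Σ-ℓ : ∀ (f : Sets → ℤ) → Σ (allFin m) (λ i → f (ℓ i)) ≡ Σ lines f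
  Σ-ℓ f = trans (Σ-tabulate (λ i → i) (λ i → f (ℓ i)))
                (trans (cong sumℤ (sym (ListP.map-tabulate (L.lookup lines) f)))
                       (cong (λ ls → sumℤ (map f ls)) (ListP.tabulate-lookup lines)))

  linesIn : Sets → Subset m
  linesIn U = V.tabulate (λ i → ℓ i ⊆ᵇ U)

  lookup-linesIn : ∀ U i → V.lookup (linesIn U) i ≡ ℓ i ⊆ᵇ U
  lookup-linesIn U i = VecP.lookup∘tabulate _ i

  ℓ⊆⟨⟩ : ∀ S i → V.lookup S i ≡ true → ℓ i ⊆ₛ ⟨ S ⟩
  ℓ⊆⟨⟩ S i i∈S v v∈ℓi =
    ⊆-span _ v (any-complete (λ i → V.lookup S i ∧ (v ∈ᵇ ℓ i)) (∈-allFin i) (cong₂ _∧_ i∈S v∈ℓi))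

  ⟨⟩-isSubspace : ∀ S → IsSubspace ⟨ S ⟩
  ⟨⟩-isSubspace S = span-isSubspace _

  ⟨⟩⊆⇔⊆linesIn : ∀ S W → IsSubspace W → ⟨ S ⟩ ⊆ᵇ W ≡ S ⊆ˢ linesIn W
  ⟨⟩⊆⇔⊆linesIn S W W-sub = ⇔-true⇒≡ to from
    where
    to : ⟨ S ⟩ ⊆ᵇ W ≡ true → S ⊆ˢ linesIn W ≡ true
    to ⟨S⟩⊆W = ⊆⇒⊆ˢ S (linesIn W) (λ i i∈S →
      trans (lookup-linesIn W i) (⊆⇒⊆ᵇ _ _ (λ v v∈ → ⊆ᵇ⇒⊆ ⟨ S ⟩ W ⟨S⟩⊆W v (ℓ⊆⟨⟩ S i i∈S v v∈))))
    from : S ⊆ˢ linesIn W ≡ true → ⟨ S ⟩ ⊆ᵇ W ≡ true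
    from S⊆ = ⊆⇒⊆ᵇ _ _ (span-least _ W W-sub (λ v v∈⋃S →
      let (i , _ , i∈S∧v∈ℓi) = any-sound (λ i → V.lookup S i ∧ (v ∈ᵇ ℓ i)) (allFin m) v∈⋃S in
      ⊆ᵇ⇒⊆ (ℓ i) W (trans (sym (lookup-linesIn W i)) (⊆ˢ⇒⊆ S (linesIn W) S⊆ i (∧-conicalˡ _ _ i∈S∧v∈ℓi)))
           v (∧-conicalʳ (V.lookup S i) _ i∈S∧v∈ℓi)))

  ⟨⟩-mono : ∀ S T → (∀ i → V.lookup S i ≡ true → V.lookup T i ≡ true) → ⟨ S ⟩ ⊆ₛ ⟨ T ⟩
  ⟨⟩-mono S T S⊆T = ⊆ᵇ⇒⊆ _ _ (trans (⟨⟩⊆⇔⊆linesIn S ⟨ T ⟩ (⟨⟩-isSubspace T))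
    (⊆⇒⊆ˢ S _ (λ i i∈S → trans (lookup-linesIn _ i) (⊆⇒⊆ᵇ _ _ (ℓ⊆⟨⟩ T i (S⊆T i i∈S))))))

  ⟨linesIn⟩ : ∀ U → IsSubspace U → ⟨ linesIn U ⟩ ≡ U
  ⟨linesIn⟩ U U-sub = ⊆-antisym _ _
    (⊆ᵇ⇒⊆ _ _ (trans (⟨⟩⊆⇔⊆linesIn (linesIn U) U U-sub) (⊆⇒⊆ˢ (linesIn U) (linesIn U) (λ _ i∈ → i∈))))
    (λ v → covered v (v ∈ᵇ zeroS) refl)
    where
    covered : ∀ v b → v ∈ᵇ zeroS ≡ b → v ∈ₛ U → v ∈ₛ ⟨ linesIn U ⟩
    covered v true  v≡0 _   = zeroS-least _ (⟨⟩-isSubspace (linesIn U)) v v≡0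
    covered v false v≢0 v∈U = ℓ⊆⟨⟩ (linesIn U) (lineIndex v v≢0)
      (trans (lookup-linesIn U (lineIndex v v≢0)) (⊆⇒⊆ᵇ (ℓ (lineIndex v v≢0)) U (subst (_⊆ₛ U) (sym (ℓ-lineIndex v v≢0)) (line-least v U U-sub v∈U))))
      v (∈-ℓ-lineIndex v v≢0)

  linesIn-E : linesIn E ≡ ⊤
  linesIn-E = lookup-ext _ _ (λ i → trans (lookup-linesIn E i) (trans (⊆⇒⊆ᵇ _ _ (E-greatest _)) (sym (lookup-⊤ i))))

  ⟨⊤⟩≡E : ⟨ ⊤ ⟩ ≡ E
  ⟨⊤⟩≡E = trans (cong ⟨_⟩ (sym linesIn-E)) (⟨linesIn⟩ E E-isSubspace)

module Contraction {q : ℕ} (F : FiniteField q) (n : ℕ) where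

  open BoolLemmas
  open ListSum
  open Enumeration
  open IndexSubset
  open import Data.Nat as ℕ using (zero; suc; _<_; _^_)
  open import Data.Nat.Properties as ℕP using ()
  open import Data.Integer as ℤ using (ℤ; 0ℤ)
  open import Data.Integer.Properties as ℤP using ()
  open import Data.List using (List; filterᵇ)
  open import Data.Vec as V using ()
  open import Data.Fin using (Fin)
  open import Data.Fin.Subset using (Subset; _∩_; _∪_; ⊤)
  open import Data.Bool using (Bool; true; false; _∧_; _∨_; not; if_then_else_)
  open import Data.Bool.Properties using (∧-conicalˡ; ∧-conicalʳ; not-involutive; ∨-zeroʳ; ∧-zeroʳ; ¬-not; if-eta; if-float; if-cong; if-cong-then; if-swap-then)
  open import Data.Empty using (⊥-elim)
  open import Data.Product using (_,_)
  open import Relation.Binary.PropositionalEquality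
  open import Algebra.Properties.AbelianGroup ℤP.+-0-abelianGroup using (inverseˡ-unique)

  open Lines F n public

  corank : (Sets → ℕ) → Sets → Sets → ℕ
  corank ρ U W = (ρ E ℕ.∸ ρ U) ℕ.∸ (ρ W ℕ.∸ ρ U)

  Σ-pick-subspace : ∀ X → IsSubspace X → (f : Sets → ℤ) → Σ subspaces (λ W → if eqSet W X then f W else 0ℤ) ≡ f X
  Σ-pick-subspace X X-sub f = begin
    Σ subspaces (λ W → if eqSet W X then f W else 0ℤ)
      ≡⟨ Σ-filterᵇ isSubspace (allSets q n) _ ⟩
    Σ (allSets q n) (λ W → if isSubspace W then (if eqSet W X then f W else 0ℤ) else 0ℤ)
      ≡⟨ Σ-cong (allSets q n) (λ W → if-swap-then (isSubspace W) (eqSet W X)) ⟩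
    Σ (allSets q n) (λ W → if eqSet W X then (if isSubspace W then f W else 0ℤ) else 0ℤ)
      ≡⟨ IsEnumeration.Σ-pick (allSets-enumeration q n) X (λ W → if isSubspace W then f W else 0ℤ) ⟩
    (if isSubspace X then f X else 0ℤ)
      ≡⟨ if-cong X-sub ⟩
    f X ∎
    where open ≡-Reasoning

  eqSet⇒≡ : ∀ X Y → eqSet X Y ≡ true → X ≡ Y
  eqSet⇒≡ = IsEnumeration.sound (allSets-enumeration q n)

  eqSet-refl : ∀ X → eqSet X X ≡ true
  eqSet-refl = IsEnumeration.complete (allSets-enumeration q n)

  ⊆-antisym-eqSet : ∀ Z W → Z ⊆ᵇ W ≡ true → W ⊆ᵇ Z ≡ true → eqSet Z W ≡ true
  ⊆-antisym-eqSet Z W Z⊆W W⊆Z = trans (cong (eqSet Z) (sym (⊆-antisym Z W (⊆ᵇ⇒⊆ Z W Z⊆W) (⊆ᵇ⇒⊆ W Z W⊆Z)))) (eqSet-refl Z)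

  _∈[_,_⟩ : Sets → Sets → Sets → Bool
  Z ∈[ X , Y ⟩ = (X ⊆ᵇ Z) ∧ (Z ⊆ᵇ Y) ∧ not (Y ⊆ᵇ Z)

  module _ (g : Sets → ℤ) (U : Sets) (g-outside : ∀ Z → U ⊆ᵇ Z ≡ false → g Z ≡ 0ℤ) where

    ⊆ᵇ-as-eqSet : ∀ Z → (if eqSet Z U then g Z else 0ℤ) ≡ (if Z ⊆ᵇ U then g Z else 0ℤ)
    ⊆ᵇ-as-eqSet Z with eqSet Z U in Z≟U
    ... | true with eqSet⇒≡ Z U Z≟U
    ...   | refl = sym (if-cong (⊆ᵇ-refl Z))
    ⊆ᵇ-as-eqSet Z | false with Z ⊆ᵇ U in Z⊆U
    ... | false = refl
    ... | true with U ⊆ᵇ Z in U⊆Z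
    ...   | false = sym (g-outside Z U⊆Z)
    ...   | true  = ⊥-elim (true≢false (trans (sym (⊆-antisym-eqSet Z U Z⊆U U⊆Z)) Z≟U))

    ⊆ᵇ-split : ∀ W Z → (if Z ⊆ᵇ W then g Z else 0ℤ)
                       ≡ (if eqSet Z W then g Z else 0ℤ) ℤ.+ (if Z ∈[ U , W ⟩ then g Z else 0ℤ)
    ⊆ᵇ-split W Z with eqSet Z W in Z≟W
    ... | true with eqSet⇒≡ Z W Z≟W
    ...   | refl rewrite ⊆ᵇ-refl Z | ∧-zeroʳ (U ⊆ᵇ Z) = sym (ℤP.+-identityʳ (g Z))
    ⊆ᵇ-split W Z | false with Z ⊆ᵇ W in Z⊆W
    ... | false rewrite ∧-zeroʳ (U ⊆ᵇ Z) = refl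
    ... | true with W ⊆ᵇ Z in W⊆Z
    ...   | true = ⊥-elim (true≢false (trans (sym (⊆-antisym-eqSet Z W Z⊆W W⊆Z)) Z≟W))
    ...   | false with U ⊆ᵇ Z in U⊆Z
    ...     | true  = sym (ℤP.+-identityˡ (g Z))
    ...     | false = g-outside Z U⊆Z

  ⊤∖_ : Subset m → Subset m
  ⊤∖ A = Matroid._─_ {m} ⊤ A

  subsetsOfPE : List (Subset m)
  subsetsOfPE = Matroid.allSubsets {m}

  -- For A ⊆ PE with U = ⟨⊤∖A⟩, signedCount Z sums (-1)^|C| over the C ⊆ A with
  -- ⟨C ∪ ⊤∖A⟩ = Z.  By inclusion–exclusion its partial sums over Z ⊆ W are [A ∩ W = ∅]
  -- for U ⊆ W, which forces signedCount to be the Möbius function μ(U, ·) when ⊤∖A is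
  -- closed (no point of A lies in U) and 0 otherwise.
  module SignedCount (A : Subset m) (U : Sets) (⟨⊤∖A⟩≡U : ⟨ ⊤∖ A ⟩ ≡ U) where

    U-isSubspace : IsSubspace U
    U-isSubspace = subst IsSubspace ⟨⊤∖A⟩≡U (⟨⟩-isSubspace (⊤∖ A))

    isClosed : Bool
    isClosed = isEmpty (A ∩ linesIn U)

    span-with : Subset m → Sets
    span-with C = ⟨ C ∪ ⊤∖ A ⟩

    term : Sets → Subset m → ℤ
    term Z C = if C ⊆ˢ A then (if eqSet Z (span-with C) then sign C else 0ℤ) else 0ℤ

    signedCount : Sets → ℤ
    signedCount Z = Σ subsetsOfPE (term Z)

    U⊆span-with : ∀ C → U ⊆ₛ span-with C
    U⊆span-with C = subst (_⊆ₛ span-with C) ⟨⊤∖A⟩≡U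
      (⟨⟩-mono (⊤∖ A) (C ∪ ⊤∖ A) (λ i i∈ → trans (lookup-∪ C (⊤∖ A) i) (trans (cong (V.lookup C i ∨_) i∈) (∨-zeroʳ _))))

    signedCount-outside : ∀ W → U ⊆ᵇ W ≡ false → signedCount W ≡ 0ℤ
    signedCount-outside W U⊈W = trans (Σ-cong subsetsOfPE term≡0) (Σ-zero subsetsOfPE)
      where
      W≢span : ∀ C → eqSet W (span-with C) ≡ false
      W≢span C = ¬-not λ W≡ → true≢false (trans (sym (⊆⇒⊆ᵇ U W (subst (U ⊆ₛ_) (sym (eqSet⇒≡ _ _ W≡)) (U⊆span-with C)))) U⊈W)
      term≡0 : ∀ C → term W C ≡ 0ℤ
      term≡0 C = trans (if-cong-then (C ⊆ˢ A) (if-cong (W≢span C))) (if-eta (C ⊆ˢ A))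

    span-with⊆ : ∀ W → IsSubspace W → ∀ C → span-with C ⊆ᵇ W ≡ C ⊆ˢ linesIn W ∧ U ⊆ᵇ W
    span-with⊆ W W-sub C = begin
      span-with C ⊆ᵇ W                              ≡⟨ ⟨⟩⊆⇔⊆linesIn (C ∪ ⊤∖ A) W W-sub ⟩
      (C ∪ ⊤∖ A) ⊆ˢ linesIn W                       ≡⟨ ∪-⊆ˢ C (⊤∖ A) (linesIn W) ⟩
      C ⊆ˢ linesIn W ∧ (⊤∖ A) ⊆ˢ linesIn W          ≡⟨ cong (C ⊆ˢ linesIn W ∧_) (sym (⟨⟩⊆⇔⊆linesIn (⊤∖ A) W W-sub)) ⟩
      C ⊆ˢ linesIn W ∧ ⟨ ⊤∖ A ⟩ ⊆ᵇ W                ≡⟨ cong (λ X → C ⊆ˢ linesIn W ∧ X ⊆ᵇ W) ⟨⊤∖A⟩≡U ⟩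
      C ⊆ˢ linesIn W ∧ U ⊆ᵇ W                       ∎
      where open ≡-Reasoning

    Σ-⊆-term : ∀ W → IsSubspace W → ∀ C → Σ subspaces (λ Z → if Z ⊆ᵇ W then term Z C else 0ℤ)
                                          ≡ (if U ⊆ᵇ W then (if C ⊆ˢ (A ∩ linesIn W) then sign C else 0ℤ) else 0ℤ)
    Σ-⊆-term W W-sub C = begin
      Σ subspaces (λ Z → if Z ⊆ᵇ W then term Z C else 0ℤ)
        ≡⟨ Σ-cong subspaces (λ Z → reverse (Z ⊆ᵇ W) (C ⊆ˢ A) (eqSet Z (span-with C))) ⟩
      Σ subspaces (λ Z → if eqSet Z (span-with C) then (if C ⊆ˢ A then (if Z ⊆ᵇ W then sign C else 0ℤ) else 0ℤ) else 0ℤ)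
        ≡⟨ Σ-pick-subspace (span-with C) (⟨⟩-isSubspace (C ∪ ⊤∖ A)) (λ Z → if C ⊆ˢ A then (if Z ⊆ᵇ W then sign C else 0ℤ) else 0ℤ) ⟩
      (if C ⊆ˢ A then (if span-with C ⊆ᵇ W then sign C else 0ℤ) else 0ℤ)
        ≡⟨ if-cong-then (C ⊆ˢ A) (if-cong (span-with⊆ W W-sub C)) ⟩
      (if C ⊆ˢ A then (if C ⊆ˢ linesIn W ∧ U ⊆ᵇ W then sign C else 0ℤ) else 0ℤ)
        ≡⟨ regroup (C ⊆ˢ A) (C ⊆ˢ linesIn W) (U ⊆ᵇ W) ⟩
      (if U ⊆ᵇ W then (if C ⊆ˢ A ∧ C ⊆ˢ linesIn W then sign C else 0ℤ) else 0ℤ)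
        ≡⟨ if-cong-then (U ⊆ᵇ W) (if-cong (⊆ˢ-∩ C A (linesIn W))) ⟩
      (if U ⊆ᵇ W then (if C ⊆ˢ (A ∩ linesIn W) then sign C else 0ℤ) else 0ℤ) ∎
      where
      open ≡-Reasoning
      reverse : ∀ a b c → (if a then (if b then (if c then sign C else 0ℤ) else 0ℤ) else 0ℤ)
                        ≡ (if c then (if b then (if a then sign C else 0ℤ) else 0ℤ) else 0ℤ)
      reverse true  true  true  = refl
      reverse true  true  false = refl
      reverse true  false c     = sym (if-eta c)
      reverse false b     true  = sym (if-eta b)
      reverse false true  false = refl
      reverse false false false = refl
      regroup : ∀ a b c → (if a then (if b ∧ c then sign C else 0ℤ) else 0ℤ)
                        ≡ (if c then (if a ∧ b then sign C else 0ℤ) else 0ℤ)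
      regroup true  true  true  = refl
      regroup true  true  false = refl
      regroup true  false c     = sym (if-eta c)
      regroup false b     true  = refl
      regroup false b     false = refl

    Σ-signedCount-⊆ : ∀ W → IsSubspace W →
      Σ subspaces (λ Z → if Z ⊆ᵇ W then signedCount Z else 0ℤ) ≡ (if U ⊆ᵇ W then iverson (isEmpty (A ∩ linesIn W)) else 0ℤ)
    Σ-signedCount-⊆ W W-sub = begin
      Σ subspaces (λ Z → if Z ⊆ᵇ W then signedCount Z else 0ℤ)
        ≡⟨ Σ-cong subspaces (λ Z → sym (Σ-if (Z ⊆ᵇ W) subsetsOfPE (term Z))) ⟩
      Σ subspaces (λ Z → Σ subsetsOfPE (λ C → if Z ⊆ᵇ W then term Z C else 0ℤ))
        ≡⟨ Σ-swap subspaces subsetsOfPE _ ⟩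
      Σ subsetsOfPE (λ C → Σ subspaces (λ Z → if Z ⊆ᵇ W then term Z C else 0ℤ))
        ≡⟨ Σ-cong subsetsOfPE (Σ-⊆-term W W-sub) ⟩
      Σ subsetsOfPE (λ C → if U ⊆ᵇ W then (if C ⊆ˢ (A ∩ linesIn W) then sign C else 0ℤ) else 0ℤ)
        ≡⟨ Σ-if (U ⊆ᵇ W) subsetsOfPE _ ⟩
      (if U ⊆ᵇ W then Σ subsetsOfPE (λ C → if C ⊆ˢ (A ∩ linesIn W) then sign C else 0ℤ) else 0ℤ)
        ≡⟨ if-cong-then (U ⊆ᵇ W) (alternating-sum m (A ∩ linesIn W)) ⟩
      (if U ⊆ᵇ W then iverson (isEmpty (A ∩ linesIn W)) else 0ℤ) ∎
      where open ≡-Reasoning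

    A∩linesIn-isEmpty : ∀ W → IsSubspace W → U ⊆ᵇ W ≡ true → isEmpty (A ∩ linesIn W) ≡ W ⊆ᵇ U ∧ isClosed
    A∩linesIn-isEmpty W W-sub U⊆W with W ⊆ᵇ U in W⊆U
    ... | true with ⊆-antisym W U (⊆ᵇ⇒⊆ W U W⊆U) (⊆ᵇ⇒⊆ U W U⊆W)
    ...   | refl = refl
    A∩linesIn-isEmpty W W-sub U⊆W | false with ⊆ᵇ-false⇒∃ W U W⊆U
    ... | w , w∈W , w∉U = ¬-not (λ empty → true≢false (trans (sym i∈A∩W) (isEmpty⇒lookup (A ∩ linesIn W) empty i)))
      where
      w≢0 : IsNonzero w
      w≢0 = ¬-not (λ w≡0 → true≢false (trans (sym (zeroS-least U U-isSubspace w w≡0)) w∉U))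
      i : Fin m
      i = lineIndex w w≢0
      i∈A : V.lookup A i ≡ true
      i∈A = ¬-not {y = false} (λ i∉A → true≢false (trans (sym (subst (ℓ i ⊆ₛ_) ⟨⊤∖A⟩≡U
        (ℓ⊆⟨⟩ (⊤∖ A) i (trans (lookup-─ ⊤ A i) (cong₂ (λ x y → x ∧ not y) (lookup-⊤ i) i∉A))) w (∈-ℓ-lineIndex w w≢0))) w∉U))
      i∈W : V.lookup (linesIn W) i ≡ true
      i∈W = trans (lookup-linesIn W i)
        (⊆⇒⊆ᵇ _ _ (subst (_⊆ₛ W) (sym (ℓ-lineIndex w w≢0)) (line-least w W W-sub w∈W)))
      i∈A∩W : V.lookup (A ∩ linesIn W) i ≡ true
      i∈A∩W = trans (lookup-∩ A (linesIn W) i) (cong₂ _∧_ i∈A i∈W)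

    signedCount-U : signedCount U ≡ iverson isClosed
    signedCount-U = begin
      signedCount U                                                ≡⟨ sym (Σ-pick-subspace U U-isSubspace signedCount) ⟩
      Σ subspaces (λ Z → if eqSet Z U then signedCount Z else 0ℤ)  ≡⟨ Σ-cong subspaces (⊆ᵇ-as-eqSet signedCount U signedCount-outside) ⟩
      Σ subspaces (λ Z → if Z ⊆ᵇ U then signedCount Z else 0ℤ)     ≡⟨ Σ-signedCount-⊆ U U-isSubspace ⟩
      (if U ⊆ᵇ U then iverson isClosed else 0ℤ)                    ≡⟨ if-cong (⊆ᵇ-refl U) ⟩
      iverson isClosed                                             ∎
      where open ≡-Reasoning

    signedCount-below : Sets → ℤ
    signedCount-below W = Σ subspaces (λ Z → if Z ∈[ U , W ⟩ then signedCount Z else 0ℤ)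

    signedCount+below≡0 : ∀ W → IsSubspace W → U ⊆ᵇ W ≡ true → W ⊆ᵇ U ≡ false →
                          signedCount W ℤ.+ signedCount-below W ≡ 0ℤ
    signedCount+below≡0 W W-sub U⊆W W⊈U = begin
      signedCount W ℤ.+ signedCount-below W
        ≡⟨ cong (ℤ._+ signedCount-below W) (sym (Σ-pick-subspace W W-sub signedCount)) ⟩
      Σ subspaces (λ Z → if eqSet Z W then signedCount Z else 0ℤ) ℤ.+ signedCount-below W
        ≡⟨ sym (Σ-distrib-+ subspaces _ _) ⟩
      Σ subspaces (λ Z → (if eqSet Z W then signedCount Z else 0ℤ) ℤ.+ (if Z ∈[ U , W ⟩ then signedCount Z else 0ℤ))
        ≡⟨ Σ-cong subspaces (λ Z → sym (⊆ᵇ-split signedCount U signedCount-outside W Z)) ⟩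
      Σ subspaces (λ Z → if Z ⊆ᵇ W then signedCount Z else 0ℤ)
        ≡⟨ Σ-signedCount-⊆ W W-sub ⟩
      (if U ⊆ᵇ W then iverson (isEmpty (A ∩ linesIn W)) else 0ℤ)
        ≡⟨ if-cong U⊆W ⟩
      iverson (isEmpty (A ∩ linesIn W))
        ≡⟨ cong iverson (trans (A∩linesIn-isEmpty W W-sub U⊆W) (cong (_∧ isClosed) W⊈U)) ⟩
      0ℤ ∎
      where open ≡-Reasoning

    -- Induction along the recursion defining mu; the fuel bound card W < q ^ fuel * card U
    -- leaves enough fuel for every subspace strictly between U and W.
    signedCount≡mu : ∀ fuel W → IsSubspace W → card W < q ^ fuel ℕ.* card U →
                     signedCount W ≡ (if isClosed then mu fuel U W else 0ℤ)
    signedCount≡mu zero W W-sub card-W< = trans (signedCount-outside W U⊈W) (sym (if-eta isClosed))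
      where
      U⊈W : U ⊆ᵇ W ≡ false
      U⊈W = ¬-not (λ U⊆W → ℕP.<⇒≱ (subst (card W <_) (ℕP.*-identityˡ (card U)) card-W<) (card-mono _ _ (⊆ᵇ⇒⊆ U W U⊆W)))
    signedCount≡mu (suc fuel) W W-sub card-W< with U ⊆ᵇ W in U⊆W | W ⊆ᵇ U in W⊆U
    ... | false | _ = trans (signedCount-outside W U⊆W) (sym (if-eta isClosed))
    ... | true | true with ⊆-antisym W U (⊆ᵇ⇒⊆ W U W⊆U) (⊆ᵇ⇒⊆ U W U⊆W)
    ...   | refl = signedCount-U
    signedCount≡mu (suc fuel) W W-sub card-W< | true | false = begin
      signedCount W                    ≡⟨ inverseˡ-unique _ _ (signedCount+below≡0 W W-sub U⊆W W⊆U) ⟩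
      ℤ.- signedCount-below W        ≡⟨ cong ℤ.-_ below ⟩
      ℤ.- (if isClosed then Σ (filterᵇ (_∈[ U , W ⟩) subspaces) (mu fuel U) else 0ℤ)
                                       ≡⟨ if-float ℤ.-_ isClosed ⟩
      (if isClosed then ℤ.- Σ (filterᵇ (_∈[ U , W ⟩) subspaces) (mu fuel U) else 0ℤ) ∎
      where
      open ≡-Reasoning
      in-interval : ∀ Z → IsSubspace Z → (if Z ∈[ U , W ⟩ then signedCount Z else 0ℤ)
                                         ≡ (if isClosed then (if Z ∈[ U , W ⟩ then mu fuel U Z else 0ℤ) else 0ℤ)
      in-interval Z Z-sub with Z ∈[ U , W ⟩ in Z∈
      ... | false = sym (if-eta isClosed)
      ... | true  = signedCount≡mu fuel Z Z-sub card-Z<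
        where
        Z⊆W : Z ⊆ᵇ W ≡ true
        Z⊆W = ∧-conicalˡ (Z ⊆ᵇ W) _ (∧-conicalʳ (U ⊆ᵇ Z) _ Z∈)
        W⊈Z : W ⊆ᵇ Z ≡ false
        W⊈Z = trans (sym (not-involutive _)) (cong not (∧-conicalʳ (Z ⊆ᵇ W) _ (∧-conicalʳ (U ⊆ᵇ Z) _ Z∈)))
        card-Z< : card Z < q ^ fuel ℕ.* card U
        card-Z< with ⊆ᵇ-false⇒∃ W Z W⊈Z
        ... | v , v∈W , v∉Z = ℕP.*-cancelˡ-< q (card Z) (q ^ fuel ℕ.* card U)
          (ℕP.≤-<-trans (q*card≤card Z W v Z-sub W-sub (⊆ᵇ⇒⊆ Z W Z⊆W) v∈W v∉Z)
                        (subst (card W <_) (ℕP.*-assoc q (q ^ fuel) (card U)) card-W<))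
      below : signedCount-below W ≡ (if isClosed then Σ (filterᵇ (_∈[ U , W ⟩) subspaces) (mu fuel U) else 0ℤ)
      below = begin
        signedCount-below W
          ≡⟨ Σ-cong-∈ subspaces (λ Z Z∈ → in-interval Z (∈-subspaces⁻ Z∈)) ⟩
        Σ subspaces (λ Z → if isClosed then (if Z ∈[ U , W ⟩ then mu fuel U Z else 0ℤ) else 0ℤ)
          ≡⟨ Σ-if isClosed subspaces _ ⟩
        (if isClosed then Σ subspaces (λ Z → if Z ∈[ U , W ⟩ then mu fuel U Z else 0ℤ) else 0ℤ)
          ≡⟨ if-cong-then isClosed (sym (Σ-filterᵇ (_∈[ U , W ⟩) subspaces (mu fuel U))) ⟩
        (if isClosed then Σ (filterᵇ (_∈[ U , W ⟩) subspaces) (mu fuel U) else 0ℤ) ∎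

    -- The exponent depends on C only through ⟨C ∪ ⊤∖A⟩; grouping the C by it gives signedCount.
    Σ-sign-x^corank≡Σ-signedCount : ∀ (ρ : Sets → ℕ) k →
      Σ subsetsOfPE (λ C → if C ⊆ˢ A then mono (sign C) (corank ρ U (span-with C)) k else 0ℤ)
      ≡ Σ subspaces (λ W → if corank ρ U W ℕ.≡ᵇ k then signedCount W else 0ℤ)
    Σ-sign-x^corank≡Σ-signedCount ρ k = begin
      Σ subsetsOfPE (λ C → if C ⊆ˢ A then mono (sign C) (e (span-with C)) k else 0ℤ)
        ≡⟨ Σ-cong subsetsOfPE (λ C → if-cong-then (C ⊆ˢ A) (sym (Σ-pick-subspace (span-with C) (⟨⟩-isSubspace (C ∪ ⊤∖ A))
                                                                                    (λ W → mono (sign C) (e W) k)))) ⟩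
      Σ subsetsOfPE (λ C → if C ⊆ˢ A then Σ subspaces (λ W → if eqSet W (span-with C) then mono (sign C) (e W) k else 0ℤ) else 0ℤ)
        ≡⟨ Σ-cong subsetsOfPE (λ C → trans (sym (Σ-if (C ⊆ˢ A) subspaces _))
                                           (Σ-cong subspaces (λ W → exponent-outermost (C ⊆ˢ A) (eqSet W (span-with C)) (e W ℕ.≡ᵇ k) (sign C)))) ⟩
      Σ subsetsOfPE (λ C → Σ subspaces (λ W → if e W ℕ.≡ᵇ k then term W C else 0ℤ))
        ≡⟨ Σ-swap subsetsOfPE subspaces _ ⟩
      Σ subspaces (λ W → Σ subsetsOfPE (λ C → if e W ℕ.≡ᵇ k then term W C else 0ℤ))
        ≡⟨ Σ-cong subspaces (λ W → Σ-if (e W ℕ.≡ᵇ k) subsetsOfPE _) ⟩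
      Σ subspaces (λ W → if e W ℕ.≡ᵇ k then signedCount W else 0ℤ) ∎
      where
      open ≡-Reasoning
      e : Sets → ℕ
      e = corank ρ U
      exponent-outermost : ∀ a b c (s : ℤ) → (if a then (if b then (if c then s else 0ℤ) else 0ℤ) else 0ℤ)
                                           ≡ (if c then (if a then (if b then s else 0ℤ) else 0ℤ) else 0ℤ)
      exponent-outermost true  true  true  s = refl
      exponent-outermost true  true  false s = refl
      exponent-outermost true  false c     s = sym (if-eta c)
      exponent-outermost false b     c     s = sym (if-eta c)

    Σ-sign-x^corank : ∀ (ρ : Sets → ℕ) k →
      Σ subsetsOfPE (λ C → if C ⊆ˢ A then mono (sign C) (corank ρ U (span-with C)) k else 0ℤ)
      ≡ (if isClosed then χ/ ρ U k else 0ℤ)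
    Σ-sign-x^corank ρ k = begin
      Σ subsetsOfPE (λ C → if C ⊆ˢ A then mono (sign C) (e (span-with C)) k else 0ℤ)
        ≡⟨ Σ-sign-x^corank≡Σ-signedCount ρ k ⟩
      Σ subspaces (λ W → if e W ℕ.≡ᵇ k then signedCount W else 0ℤ)
        ≡⟨ Σ-cong-∈ subspaces (λ W W∈ → if-cong-then (e W ℕ.≡ᵇ k) (signedCount≡mu (suc n) W (∈-subspaces⁻ W∈) (card-bound W))) ⟩
      Σ subspaces (λ W → if e W ℕ.≡ᵇ k then (if isClosed then mu (suc n) U W else 0ℤ) else 0ℤ)
        ≡⟨ Σ-cong subspaces (λ W → closed-outermost (U ⊆ᵇ W) (e W ℕ.≡ᵇ k) (mu (suc n) U W) (mu-⊈ W)) ⟩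
      Σ subspaces (λ W → if isClosed then (if U ⊆ᵇ W then (if e W ℕ.≡ᵇ k then mu (suc n) U W else 0ℤ) else 0ℤ) else 0ℤ)
        ≡⟨ Σ-if isClosed subspaces _ ⟩
      (if isClosed then Σ subspaces (λ W → if U ⊆ᵇ W then (if e W ℕ.≡ᵇ k then mu (suc n) U W else 0ℤ) else 0ℤ) else 0ℤ)
        ≡⟨ if-cong-then isClosed (sym (Σ-filterᵇ (U ⊆ᵇ_) subspaces (λ W → if e W ℕ.≡ᵇ k then mu (suc n) U W else 0ℤ))) ⟩
      (if isClosed then χ/ ρ U k else 0ℤ) ∎
      where
      open ≡-Reasoning
      e : Sets → ℕ
      e = corank ρ U
      card-bound : ∀ W → card W < q ^ suc n ℕ.* card U
      card-bound W = ℕP.<-≤-trans (ℕP.≤-<-trans (card≤q^n W) (ℕP.^-monoʳ-< q 2≤q (ℕP.n<1+n n)))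
                                  (ℕP.m≤m*n (q ^ suc n) (card U) {{ℕ.>-nonZero (card-pos U U-isSubspace)}})
      mu-⊈ : ∀ W → U ⊆ᵇ W ≡ false → mu (suc n) U W ≡ 0ℤ
      mu-⊈ W U⊈W rewrite U⊈W = refl
      closed-outermost : ∀ u c (x : ℤ) → (u ≡ false → x ≡ 0ℤ) →
        (if c then (if isClosed then x else 0ℤ) else 0ℤ) ≡ (if isClosed then (if u then (if c then x else 0ℤ) else 0ℤ) else 0ℤ)
      closed-outermost u c x x≡0 with isClosed
      ... | false = if-eta c
      ... | true with u
      ...   | true  = refl
      ...   | false = trans (if-cong-then c (x≡0 refl)) (if-eta c)

module ProjectiveSum {q : ℕ} (F : FiniteField q) (n : ℕ) where

  open BoolLemmas
  open ListSum
  open Enumeration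
  open IndexSubset
  open VSetProperties using (lookup-ext)
  open import Data.Nat as ℕ using ()
  open import Data.List using (filterᵇ)
  open import Data.Integer using (ℤ; 0ℤ)
  open import Data.Vec as V using ()
  open import Data.Vec.Properties as VecP using ()
  open import Data.Fin.Subset using (Subset; _∩_; _∪_; ∣_∣; ⊤)
  open import Data.Bool using (Bool; true; false; _∧_; _∨_; not; if_then_else_)
  open import Data.Bool.Properties using (∧-conicalˡ; ∧-conicalʳ; ∧-inverseˡ; ∨-inverseʳ; not-involutive; if-∧; if-eta; if-cong)
  open import Relation.Binary.PropositionalEquality

  open Contraction F n public

  ⊤∖-involutive : ∀ A → ⊤∖ (⊤∖ A) ≡ A
  ⊤∖-involutive A = lookup-ext _ A (λ i → begin
    V.lookup (⊤∖ (⊤∖ A)) i                       ≡⟨ lookup-─ ⊤ (⊤∖ A) i ⟩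
    V.lookup ⊤ i ∧ not (V.lookup (⊤∖ A) i)       ≡⟨ cong₂ (λ x y → x ∧ not y) (lookup-⊤ i) (lookup-─ ⊤ A i) ⟩
    not (V.lookup ⊤ i ∧ not (V.lookup A i))      ≡⟨ cong (λ x → not (x ∧ not (V.lookup A i))) (lookup-⊤ i) ⟩
    not (not (V.lookup A i))                     ≡⟨ not-involutive _ ⟩
    V.lookup A i                                 ∎)
    where open ≡-Reasoning

  ∪-⊤∖ : ∀ A → A ∪ ⊤∖ A ≡ ⊤
  ∪-⊤∖ A = lookup-ext _ ⊤ (λ i → begin
    V.lookup (A ∪ ⊤∖ A) i                        ≡⟨ lookup-∪ A (⊤∖ A) i ⟩
    V.lookup A i ∨ V.lookup (⊤∖ A) i             ≡⟨ cong (V.lookup A i ∨_) (trans (lookup-─ ⊤ A i) (cong (_∧ not (V.lookup A i)) (lookup-⊤ i))) ⟩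
    V.lookup A i ∨ not (V.lookup A i)            ≡⟨ ∨-inverseʳ (V.lookup A i) ⟩
    true                                         ≡⟨ sym (lookup-⊤ i) ⟩
    V.lookup ⊤ i                                 ∎)
    where open ≡-Reasoning

  linesOutside : Sets → Subset m
  linesOutside U = V.map not (linesIn U)

  lookup-linesOutside : ∀ U i → V.lookup (linesOutside U) i ≡ not (ℓ i ⊆ᵇ U)
  lookup-linesOutside U i = trans (VecP.lookup-map i not (linesIn U)) (cong not (lookup-linesIn U i))

  ⊤∖linesOutside : ∀ U → ⊤∖ (linesOutside U) ≡ linesIn U
  ⊤∖linesOutside U = lookup-ext _ _ (λ i →
    trans (lookup-─ ⊤ (linesOutside U) i)
          (trans (cong₂ (λ x y → x ∧ not y) (lookup-⊤ i) (VecP.lookup-map i not (linesIn U))) (not-involutive _)))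

  module _ (ρ : Sets → ℕ) where

    χ-contract-⊤∖ : ∀ (A : Subset m) k →
      Matroid.χ/ {m} ⊤ (projRank ρ) (⊤∖ A) k
      ≡ Σ subsetsOfPE (λ C → if C ⊆ˢ A then mono (sign C) (corank ρ ⟨ ⊤∖ A ⟩ ⟨ C ∪ ⊤∖ A ⟩) k else 0ℤ)
    χ-contract-⊤∖ A k = ground-set (⊤∖ (⊤∖ A)) (⊤∖-involutive A)
      where
      ground-set : ∀ S → S ≡ A → Matroid.χ {m} S (Matroid.contractRank {m} (projRank ρ) (⊤∖ A)) k
        ≡ Σ subsetsOfPE (λ C → if C ⊆ˢ A then mono (sign C) (corank ρ ⟨ ⊤∖ A ⟩ ⟨ C ∪ ⊤∖ A ⟩) k else 0ℤ)
      ground-set S refl = trans (Σ-filterᵇ (λ C → Matroid._⊆ᵇ_ {m} C A) subsetsOfPE _)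
        (Σ-cong subsetsOfPE (λ C → cong₂ (λ b e → if b then mono (sign C) e k else 0ℤ) (⊆ᵇ≡⊆ˢ {m} C A)
           (cong (λ X → (ρ X ℕ.∸ ρ ⟨ ⊤∖ A ⟩) ℕ.∸ (ρ ⟨ C ∪ ⊤∖ A ⟩ ℕ.∸ ρ ⟨ ⊤∖ A ⟩)) (trans (cong ⟨_⟩ (∪-⊤∖ A)) ⟨⊤⟩≡E))))

  subsets-enumeration : IsEnumeration (eqVec eqBool) subsetsOfPE
  subsets-enumeration = vecsFrom-enumeration bool-enumeration m

  -- ⊤∖A is closed with span U exactly when A = linesOutside U.
  closed-complement⇔linesOutside : ∀ A U X → ⟨ ⊤∖ A ⟩ ≡ X → IsSubspace U →
    eqSet U X ∧ isEmpty (A ∩ linesIn X) ≡ eqVec eqBool A (linesOutside U)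
  closed-complement⇔linesOutside A U X ⟨⊤∖A⟩≡X U-sub = ⇔-true⇒≡ to from
    where
    to : eqSet U X ∧ isEmpty (A ∩ linesIn X) ≡ true → eqVec eqBool A (linesOutside U) ≡ true
    to h with eqSet⇒≡ U X (∧-conicalˡ _ _ h)
    ... | refl = trans (cong (eqVec eqBool A) (sym A≡)) (IsEnumeration.complete subsets-enumeration A)
      where
      A∩U-empty : isEmpty (A ∩ linesIn U) ≡ true
      A∩U-empty = ∧-conicalʳ (eqSet U U) _ h
      pointwise : ∀ i b → V.lookup A i ≡ b → V.lookup A i ≡ V.lookup (linesOutside U) i
      pointwise i true  i∈A = trans i∈A (sym (trans (lookup-linesOutside U i) (cong not ℓi⊈U)))
        where
        ℓi⊈U : ℓ i ⊆ᵇ U ≡ false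
        ℓi⊈U = trans (sym (lookup-linesIn U i)) (trans (cong (_∧ V.lookup (linesIn U) i) (sym i∈A))
                 (trans (sym (lookup-∩ A (linesIn U) i)) (isEmpty⇒lookup (A ∩ linesIn U) A∩U-empty i)))
      pointwise i false i∉A = trans i∉A (sym (trans (lookup-linesOutside U i) (cong not ℓi⊆U)))
        where
        ℓi⊆U : ℓ i ⊆ᵇ U ≡ true
        ℓi⊆U = ⊆⇒⊆ᵇ _ _ (subst (ℓ i ⊆ₛ_) ⟨⊤∖A⟩≡X
          (ℓ⊆⟨⟩ (⊤∖ A) i (trans (lookup-─ ⊤ A i) (cong₂ (λ x y → x ∧ not y) (lookup-⊤ i) i∉A))))
      A≡ : A ≡ linesOutside U
      A≡ = lookup-ext A (linesOutside U) (λ i → pointwise i (V.lookup A i) refl)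
    from : eqVec eqBool A (linesOutside U) ≡ true → eqSet U X ∧ isEmpty (A ∩ linesIn X) ≡ true
    from h with IsEnumeration.sound subsets-enumeration A (linesOutside U) h
    ... | refl = cong₂ _∧_ (trans (cong (eqSet U) X≡U) (eqSet-refl U))
                           (subst (λ Y → isEmpty (linesOutside U ∩ linesIn Y) ≡ true) (sym X≡U)
                                  (lookup⇒isEmpty (linesOutside U ∩ linesIn U) (λ i → trans (lookup-∩ (linesOutside U) (linesIn U) i)
                                    (trans (cong (_∧ V.lookup (linesIn U) i) (VecP.lookup-map i not (linesIn U)))
                                           (∧-inverseˡ (V.lookup (linesIn U) i))))))
      where
      X≡U : X ≡ U
      X≡U = trans (sym ⟨⊤∖A⟩≡X) (trans (cong ⟨_⟩ (⊤∖linesOutside U)) (⟨linesIn⟩ U U-sub))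

  -- Only the complements of flats of P(M) contribute to its weight enumerator, and the
  -- complement of the flat spanning U is linesOutside U.
  projWeightEnum≡Σ-subspaces : ∀ ρ j k →
    projWeightEnum ρ j k ≡ Σ subspaces (λ U → if ∣ linesOutside U ∣ ℕ.≡ᵇ j then χ/ ρ U k else 0ℤ)
  projWeightEnum≡Σ-subspaces ρ j k = begin
    Σ (filterᵇ (λ A → Matroid._⊆ᵇ_ {m} A ⊤ ∧ (∣ A ∣ ℕ.≡ᵇ j)) subsetsOfPE) (λ A → Matroid.χ/ {m} ⊤ (projRank ρ) (⊤∖ A) k)
      ≡⟨ Σ-filterᵇ _ subsetsOfPE _ ⟩
    Σ subsetsOfPE (λ A → if Matroid._⊆ᵇ_ {m} A ⊤ ∧ (∣ A ∣ ℕ.≡ᵇ j) then Matroid.χ/ {m} ⊤ (projRank ρ) (⊤∖ A) k else 0ℤ)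
      ≡⟨ Σ-cong subsetsOfPE (λ A → cong₂ (λ b z → if b ∧ (∣ A ∣ ℕ.≡ᵇ j) then z else 0ℤ) (trans (⊆ᵇ≡⊆ˢ {m} A ⊤) (⊆ˢ-⊤ A))
            (trans (χ-contract-⊤∖ ρ A k) (SignedCount.Σ-sign-x^corank A ⟨ ⊤∖ A ⟩ refl ρ k))) ⟩
    Σ subsetsOfPE (λ A → if ∣ A ∣ ℕ.≡ᵇ j then (if closed A then χ/ ρ ⟨ ⊤∖ A ⟩ k else 0ℤ) else 0ℤ)
      ≡⟨ Σ-cong subsetsOfPE (λ A → trans (sym (if-∧ (∣ A ∣ ℕ.≡ᵇ j)))
            (sym (Σ-pick-subspace ⟨ ⊤∖ A ⟩ (⟨⟩-isSubspace (⊤∖ A)) (λ U → if (∣ A ∣ ℕ.≡ᵇ j) ∧ closed A then χ/ ρ U k else 0ℤ)))) ⟩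
    Σ subsetsOfPE (λ A → Σ subspaces (λ U → if eqSet U ⟨ ⊤∖ A ⟩ then (if (∣ A ∣ ℕ.≡ᵇ j) ∧ closed A then χ/ ρ U k else 0ℤ) else 0ℤ))
      ≡⟨ Σ-swap subsetsOfPE subspaces _ ⟩
    Σ subspaces (λ U → Σ subsetsOfPE (λ A → if eqSet U ⟨ ⊤∖ A ⟩ then (if (∣ A ∣ ℕ.≡ᵇ j) ∧ closed A then χ/ ρ U k else 0ℤ) else 0ℤ))
      ≡⟨ Σ-cong-∈ subspaces (λ U U∈ → sum-over-A U (∈-subspaces⁻ U∈)) ⟩
    Σ subspaces (λ U → if ∣ linesOutside U ∣ ℕ.≡ᵇ j then χ/ ρ U k else 0ℤ) ∎
    where
    open ≡-Reasoning
    closed : Subset m → Bool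
    closed A = isEmpty (A ∩ linesIn ⟨ ⊤∖ A ⟩)
    regroup : ∀ e a c (x : ℤ) → (if e then (if a ∧ c then x else 0ℤ) else 0ℤ) ≡ (if e ∧ c then (if a then x else 0ℤ) else 0ℤ)
    regroup true  true  true  x = refl
    regroup true  true  false x = refl
    regroup true  false c     x = sym (if-eta c)
    regroup false a     c     x = refl
    sum-over-A : ∀ U → IsSubspace U →
      Σ subsetsOfPE (λ A → if eqSet U ⟨ ⊤∖ A ⟩ then (if (∣ A ∣ ℕ.≡ᵇ j) ∧ closed A then χ/ ρ U k else 0ℤ) else 0ℤ)
      ≡ (if ∣ linesOutside U ∣ ℕ.≡ᵇ j then χ/ ρ U k else 0ℤ)
    sum-over-A U U-sub =
      trans (Σ-cong subsetsOfPE (λ A → trans (regroup (eqSet U ⟨ ⊤∖ A ⟩) (∣ A ∣ ℕ.≡ᵇ j) (closed A) (χ/ ρ U k))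
                                             (if-cong (closed-complement⇔linesOutside A U ⟨ ⊤∖ A ⟩ refl U-sub))))
            (IsEnumeration.Σ-pick subsets-enumeration (linesOutside U) (λ A → if ∣ A ∣ ℕ.≡ᵇ j then χ/ ρ U k else 0ℤ))

module LineCount {q : ℕ} (F : FiniteField q) (n : ℕ) where

  open BoolLemmas
  open ListSum
  open Enumeration
  open IndexSubset
  open import Data.Nat as ℕ using (suc; _^_)
  open import Data.Nat.Properties as ℕP using ()
  open import Data.Integer as ℤ using (ℤ; 0ℤ; 1ℤ)
  open import Data.Integer.Properties as ℤP using ()
  open import Data.List using (allFin)
  open import Data.Vec as V using ([]; _∷_)
  open import Data.Fin using (suc)
  open import Data.Fin.Subset using (Subset; ∣_∣)
  open import Data.Fin.Subset.Properties using (∣⊤∣≡n; ∣∁p∣≡n∸∣p∣; ∣p∣≤n)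
  open import Data.Bool using (Bool; true; false; _∧_; not; if_then_else_)
  open import Data.Bool.Properties using (∧-identityʳ; ∧-zeroʳ; ¬-not; if-eta; if-cong; if-cong-then; if-swap-then)
  open import Data.List.Membership.Propositional using (_∈_)
  open import Data.Product using (proj₁; proj₂)
  open import Relation.Binary.PropositionalEquality

  open ProjectiveSum F n public

  ∣∣≡Σ : ∀ {k} (S : Subset k) → ℤ.+ ∣ S ∣ ≡ Σ (allFin k) (λ i → iverson (V.lookup S i))
  ∣∣≡Σ []          = refl
  ∣∣≡Σ {suc k} (b ∷ S) = trans (head b) (cong (λ z → iverson b ℤ.+ z)
    (trans (∣∣≡Σ S) (sym (trans (Σ-tabulate {k = k} suc _) (sym (Σ-tabulate {k = k} (λ i → i) _))))))
    where
    head : ∀ b → ℤ.+ ∣ b ∷ S ∣ ≡ iverson b ℤ.+ ℤ.+ ∣ S ∣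
    head true  = ℤP.pos-+ 1 ∣ S ∣
    head false = sym (ℤP.+-identityˡ _)

  nonzeroCount : Sets → ℤ
  nonzeroCount L = Σ allV (λ v → iverson ((v ∈ᵇ L) ∧ not (v ∈ᵇ zeroS)))

  cardℤ≡nonzeroCount+1 : ∀ L → IsSubspace L → cardℤ L ≡ nonzeroCount L ℤ.+ 1ℤ
  cardℤ≡nonzeroCount+1 L L-sub = begin
    cardℤ L
      ≡⟨ Σ-cong allV (λ v → trans (split (v ∈ᵇ L) (v ∈ᵇ zeroS)) (cong (λ z → iverson ((v ∈ᵇ L) ∧ not (v ∈ᵇ zeroS)) ℤ.+ z) (if-cong (∈ᵇ-zeroS v)))) ⟩
    Σ allV (λ v → iverson ((v ∈ᵇ L) ∧ not (v ∈ᵇ zeroS)) ℤ.+ (if eqVect v 0v then iverson (v ∈ᵇ L) else 0ℤ))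
      ≡⟨ Σ-distrib-+ allV _ _ ⟩
    nonzeroCount L ℤ.+ Σ allV (λ v → if eqVect v 0v then iverson (v ∈ᵇ L) else 0ℤ)
      ≡⟨ cong (λ z → nonzeroCount L ℤ.+ z) (trans (IsEnumeration.Σ-pick allV-enumeration 0v (λ v → iverson (v ∈ᵇ L)))
                                           (cong iverson (0∈ L-sub))) ⟩
    nonzeroCount L ℤ.+ 1ℤ ∎
    where
    open ≡-Reasoning
    split : ∀ a z → iverson a ≡ iverson (a ∧ not z) ℤ.+ (if z then iverson a else 0ℤ)
    split true  true  = refl
    split true  false = refl
    split false true  = refl
    split false false = refl

  Σ-pick-line : ∀ X → X ∈ lines → (f : Sets → ℤ) → Σ lines (λ L → if eqSet L X then f L else 0ℤ) ≡ f X
  Σ-pick-line X X∈ f = begin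
    Σ lines (λ L → if eqSet L X then f L else 0ℤ)
      ≡⟨ Σ-filterᵇ isLine subspaces _ ⟩
    Σ subspaces (λ L → if isLine L then (if eqSet L X then f L else 0ℤ) else 0ℤ)
      ≡⟨ Σ-cong subspaces (λ L → if-swap-then (isLine L) (eqSet L X)) ⟩
    Σ subspaces (λ L → if eqSet L X then (if isLine L then f L else 0ℤ) else 0ℤ)
      ≡⟨ Σ-pick-subspace X (proj₁ (∈-lines⁻ X∈)) _ ⟩
    (if isLine X then f X else 0ℤ)
      ≡⟨ if-cong (proj₂ (∈-filterᵇ⁻ isLine {subspaces} X∈)) ⟩
    f X ∎
    where
    open ≡-Reasoning
    isLine : Sets → Bool
    isLine W = dim W ℕ.≡ᵇ 1

  line⊆ᵇ≡∈ᵇ : ∀ v U → IsSubspace U → line v ⊆ᵇ U ≡ v ∈ᵇ U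
  line⊆ᵇ≡∈ᵇ v U U-sub = ⇔-true⇒≡ (λ line⊆U → ⊆ᵇ⇒⊆ _ _ line⊆U v (∈-line v)) (λ v∈U → ⊆⇒⊆ᵇ _ _ (line-least v U U-sub v∈U))

  -- A nonzero vector lies on exactly one line.
  Σ-lines-through : ∀ v → IsNonzero v → ∀ U → IsSubspace U → Σ lines (λ L → iverson ((L ⊆ᵇ U) ∧ (v ∈ᵇ L))) ≡ iverson (v ∈ᵇ U)
  Σ-lines-through v v≢0 U U-sub =
    trans (Σ-cong-∈ lines (λ L L∈ → on-line L L∈ (v ∈ᵇ L) refl))
          (trans (Σ-pick-line (line v) (line-∈-lines v v≢0) (λ L → iverson (L ⊆ᵇ U))) (cong iverson (line⊆ᵇ≡∈ᵇ v U U-sub)))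
    where
    on-line : ∀ L → L ∈ lines → ∀ b → v ∈ᵇ L ≡ b → iverson ((L ⊆ᵇ U) ∧ b) ≡ (if eqSet L (line v) then iverson (L ⊆ᵇ U) else 0ℤ)
    on-line L L∈ true v∈L = trans (cong iverson (∧-identityʳ (L ⊆ᵇ U)))
      (sym (if-cong (trans (cong (eqSet L) (line≡ L∈ v v∈L v≢0)) (eqSet-refl L))))
    on-line L L∈ false v∉L = trans (cong iverson (∧-zeroʳ (L ⊆ᵇ U)))
      (sym (if-cong (¬-not (λ L≡ → true≢false (trans (sym (subst (v ∈ₛ_) (sym (eqSet⇒≡ L (line v) L≡)) (∈-line v))) v∉L)))))

  nonzeroCount-ℓ : ∀ i → nonzeroCount (ℓ i) ≡ ℤ.+ (q ℕ.∸ 1)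
  nonzeroCount-ℓ i = +-cancelʳ 1ℤ _ _ (begin
    nonzeroCount (ℓ i) ℤ.+ 1ℤ     ≡⟨ sym (cardℤ≡nonzeroCount+1 (ℓ i) (ℓ-isSubspace i)) ⟩
    cardℤ (ℓ i)                   ≡⟨ sym (card≡cardℤ (ℓ i)) ⟩
    ℤ.+ card (ℓ i)                ≡⟨ cong ℤ.+_ (trans (card-ℓ i) (sym (ℕP.m∸n+n≡m (ℕP.<⇒≤ 2≤q)))) ⟩
    ℤ.+ (q ℕ.∸ 1 ℕ.+ 1)           ≡⟨ ℤP.pos-+ (q ℕ.∸ 1) 1 ⟩
    ℤ.+ (q ℕ.∸ 1) ℤ.+ 1ℤ          ∎)
    where
    open ≡-Reasoning
    open import Algebra.Properties.AbelianGroup ℤP.+-0-abelianGroup using () renaming (∙-cancelʳ to +-cancelʳ)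

  -- Double counting of the pairs (L, v) with L ⊆ U a line and v ∈ L nonzero.
  Σ-nonzeroCount-linesIn : ∀ U → IsSubspace U →
    Σ (allFin m) (λ i → if ℓ i ⊆ᵇ U then nonzeroCount (ℓ i) else 0ℤ) ≡ nonzeroCount U
  Σ-nonzeroCount-linesIn U U-sub = begin
    Σ (allFin m) (λ i → if ℓ i ⊆ᵇ U then nonzeroCount (ℓ i) else 0ℤ)
      ≡⟨ Σ-cong (allFin m) (λ i → sym (Σ-if (ℓ i ⊆ᵇ U) allV _)) ⟩
    Σ (allFin m) (λ i → Σ allV (λ v → if ℓ i ⊆ᵇ U then iverson ((v ∈ᵇ ℓ i) ∧ not (v ∈ᵇ zeroS)) else 0ℤ))
      ≡⟨ Σ-swap (allFin m) allV _ ⟩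
    Σ allV (λ v → Σ (allFin m) (λ i → if ℓ i ⊆ᵇ U then iverson ((v ∈ᵇ ℓ i) ∧ not (v ∈ᵇ zeroS)) else 0ℤ))
      ≡⟨ Σ-cong allV (λ v → trans (Σ-cong (allFin m) (λ i → nonzero-outermost (ℓ i ⊆ᵇ U) (v ∈ᵇ ℓ i) (v ∈ᵇ zeroS)))
                                   (Σ-if (not (v ∈ᵇ zeroS)) (allFin m) _)) ⟩
    Σ allV (λ v → if not (v ∈ᵇ zeroS) then Σ (allFin m) (λ i → iverson ((ℓ i ⊆ᵇ U) ∧ (v ∈ᵇ ℓ i))) else 0ℤ)
      ≡⟨ Σ-cong allV (λ v → if-cong-then (not (v ∈ᵇ zeroS)) (Σ-ℓ (λ L → iverson ((L ⊆ᵇ U) ∧ (v ∈ᵇ L))))) ⟩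
    Σ allV (λ v → if not (v ∈ᵇ zeroS) then Σ lines (λ L → iverson ((L ⊆ᵇ U) ∧ (v ∈ᵇ L))) else 0ℤ)
      ≡⟨ Σ-cong allV (λ v → count-v v (v ∈ᵇ zeroS) refl) ⟩
    nonzeroCount U ∎
    where
    open ≡-Reasoning
    nonzero-outermost : ∀ a b z → (if a then iverson (b ∧ not z) else 0ℤ) ≡ (if not z then iverson (a ∧ b) else 0ℤ)
    nonzero-outermost true  true  true  = refl
    nonzero-outermost true  true  false = refl
    nonzero-outermost true  false z     = sym (if-eta (not z))
    nonzero-outermost false b     true  = refl
    nonzero-outermost false b     false = refl
    count-v : ∀ v b → v ∈ᵇ zeroS ≡ b →
      (if not b then Σ lines (λ L → iverson ((L ⊆ᵇ U) ∧ (v ∈ᵇ L))) else 0ℤ) ≡ iverson ((v ∈ᵇ U) ∧ not b)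
    count-v v true  _   = cong iverson (sym (∧-zeroʳ (v ∈ᵇ U)))
    count-v v false v≢0 = trans (Σ-lines-through v v≢0 U U-sub) (cong iverson (sym (∧-identityʳ (v ∈ᵇ U))))

  ∣linesIn∣*[q-1]≡nonzeroCount : ∀ U → IsSubspace U → ℤ.+ (∣ linesIn U ∣ ℕ.* (q ℕ.∸ 1)) ≡ nonzeroCount U
  ∣linesIn∣*[q-1]≡nonzeroCount U U-sub = begin
    ℤ.+ (∣ linesIn U ∣ ℕ.* (q ℕ.∸ 1))
      ≡⟨ ℤP.pos-* ∣ linesIn U ∣ (q ℕ.∸ 1) ⟩
    ℤ.+ ∣ linesIn U ∣ ℤ.* q-1
      ≡⟨ cong (ℤ._* q-1) (trans (∣∣≡Σ (linesIn U)) (Σ-cong (allFin m) (λ i → cong iverson (lookup-linesIn U i)))) ⟩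
    Σ (allFin m) (λ i → iverson (ℓ i ⊆ᵇ U)) ℤ.* q-1
      ≡⟨ trans (ℤP.*-comm _ q-1) (sym (Σ-*ˡ (allFin m) q-1 _)) ⟩
    Σ (allFin m) (λ i → q-1 ℤ.* iverson (ℓ i ⊆ᵇ U))
      ≡⟨ Σ-cong (allFin m) (λ i → trans (times-iverson (ℓ i ⊆ᵇ U)) (if-cong-then (ℓ i ⊆ᵇ U) (sym (nonzeroCount-ℓ i)))) ⟩
    Σ (allFin m) (λ i → if ℓ i ⊆ᵇ U then nonzeroCount (ℓ i) else 0ℤ)
      ≡⟨ Σ-nonzeroCount-linesIn U U-sub ⟩
    nonzeroCount U ∎
    where
    open ≡-Reasoning
    q-1 : ℤ
    q-1 = ℤ.+ (q ℕ.∸ 1)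
    times-iverson : ∀ b → q-1 ℤ.* iverson b ≡ (if b then q-1 else 0ℤ)
    times-iverson true  = ℤP.*-identityʳ q-1
    times-iverson false = ℤP.*-zeroʳ q-1

  ∣linesIn∣*[q-1]+1≡card : ∀ U → IsSubspace U → ∣ linesIn U ∣ ℕ.* (q ℕ.∸ 1) ℕ.+ 1 ≡ card U
  ∣linesIn∣*[q-1]+1≡card U U-sub = ℤP.+-injective (begin
    ℤ.+ (∣ linesIn U ∣ ℕ.* (q ℕ.∸ 1) ℕ.+ 1)        ≡⟨ ℤP.pos-+ _ 1 ⟩
    ℤ.+ (∣ linesIn U ∣ ℕ.* (q ℕ.∸ 1)) ℤ.+ 1ℤ      ≡⟨ cong (ℤ._+ 1ℤ) (∣linesIn∣*[q-1]≡nonzeroCount U U-sub) ⟩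
    nonzeroCount U ℤ.+ 1ℤ                         ≡⟨ sym (cardℤ≡nonzeroCount+1 U U-sub) ⟩
    cardℤ U                                       ≡⟨ sym (card≡cardℤ U) ⟩
    ℤ.+ card U                                    ∎)
    where open ≡-Reasoning

  ∣linesOutside∣*[q-1]+card≡q^n : ∀ U → IsSubspace U → ∣ linesOutside U ∣ ℕ.* (q ℕ.∸ 1) ℕ.+ card U ≡ q ^ n
  ∣linesOutside∣*[q-1]+card≡q^n U U-sub = begin
    ∣ linesOutside U ∣ ℕ.* (q ℕ.∸ 1) ℕ.+ card U
      ≡⟨ cong (∣ linesOutside U ∣ ℕ.* (q ℕ.∸ 1) ℕ.+_) (sym (∣linesIn∣*[q-1]+1≡card U U-sub)) ⟩
    ∣ linesOutside U ∣ ℕ.* (q ℕ.∸ 1) ℕ.+ (∣ linesIn U ∣ ℕ.* (q ℕ.∸ 1) ℕ.+ 1)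
      ≡⟨ sym (ℕP.+-assoc (∣ linesOutside U ∣ ℕ.* (q ℕ.∸ 1)) _ 1) ⟩
    ∣ linesOutside U ∣ ℕ.* (q ℕ.∸ 1) ℕ.+ ∣ linesIn U ∣ ℕ.* (q ℕ.∸ 1) ℕ.+ 1
      ≡⟨ cong (ℕ._+ 1) (sym (ℕP.*-distribʳ-+ (q ℕ.∸ 1) ∣ linesOutside U ∣ ∣ linesIn U ∣)) ⟩
    (∣ linesOutside U ∣ ℕ.+ ∣ linesIn U ∣) ℕ.* (q ℕ.∸ 1) ℕ.+ 1
      ≡⟨ cong (λ k → k ℕ.* (q ℕ.∸ 1) ℕ.+ 1) ∣linesOutside∣+∣linesIn∣≡m ⟩
    m ℕ.* (q ℕ.∸ 1) ℕ.+ 1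
      ≡⟨ cong (λ k → k ℕ.* (q ℕ.∸ 1) ℕ.+ 1) (sym (trans (cong ∣_∣ linesIn-E) (∣⊤∣≡n m))) ⟩
    ∣ linesIn E ∣ ℕ.* (q ℕ.∸ 1) ℕ.+ 1
      ≡⟨ ∣linesIn∣*[q-1]+1≡card E E-isSubspace ⟩
    card E
      ≡⟨ card-E ⟩
    q ^ n ∎
    where
    open ≡-Reasoning
    ∣linesOutside∣+∣linesIn∣≡m : ∣ linesOutside U ∣ ℕ.+ ∣ linesIn U ∣ ≡ m
    ∣linesOutside∣+∣linesIn∣≡m = trans (cong (ℕ._+ ∣ linesIn U ∣) (∣∁p∣≡n∸∣p∣ (linesIn U))) (ℕP.m∸n+n≡m (∣p∣≤n (linesIn U)))

module Orthogonal {q : ℕ} (F : FiniteField q) (n : ℕ) (B : Vec (Fin q) n → Vec (Fin q) n → Fin q)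
                  (B-nondeg : QMatroid.IsNondegSymBilinear F n B) where

  open BoolLemmas
  open Enumeration
  open VSetProperties
  open import Data.Nat as ℕ using (_≤_; _^_)
  open import Data.Nat.Properties as ℕP using ()
  open import Data.Bool using (true; false; if_then_else_)
  open import Data.Product using (_,_)
  open ListSum
  open import Data.Integer using (ℤ; 0ℤ)
  open import Data.Bool.Properties using (if-cong)
  open import Relation.Binary.PropositionalEquality

  open LineCount F n public
  open IsNondegSymBilinear B-nondeg

  B-additiveʳ : ∀ x u w → B x (u ⊞ w) ≡ B x u + B x w
  B-additiveʳ x u w = trans (symmetric x _) (trans (additive u w x) (cong₂ _+_ (symmetric u x) (symmetric w x)))

  B-homogeneousʳ : ∀ x c w → B x (c ⊙ w) ≡ c * B x w
  B-homogeneousʳ x c w = trans (symmetric x _) (trans (homogeneous c w x) (cong (c *_) (symmetric w x)))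

  B-zeroˡ : ∀ w → B 0v w ≡ 0#
  B-zeroˡ w = trans (cong (λ z → B z w) (sym (⊙-zeroʳ 0#))) (trans (homogeneous 0# 0v w) (zeroˡ _))

  infix 25 _ᗮ
  _ᗮ : Sets → Sets
  U ᗮ = perp B U

  ∈-ᗮ⁻ : ∀ U x → x ∈ₛ U ᗮ → ∀ v → v ∈ₛ U → B x v ≡ 0#
  ∈-ᗮ⁻ U x x∈ v v∈U =
    eqFin-sound _ _ (⇒ᵇ-elim (all-allV _ (trans (sym (∈ᵇ-tabulateSet _ x)) x∈) v) v∈U)

  ∈-ᗮ⁺ : ∀ U x → (∀ v → v ∈ₛ U → B x v ≡ 0#) → x ∈ₛ U ᗮ
  ∈-ᗮ⁺ U x x⊥U = trans (∈ᵇ-tabulateSet _ x)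
    (all-allV-complete _ (λ v → ⇒ᵇ-intro (λ v∈U → trans (cong (λ z → eqFin z 0#) (x⊥U v v∈U)) (eqFin-refl 0#))))

  ᗮ-isSubspace : ∀ U → IsSubspace (U ᗮ)
  ᗮ-isSubspace U = isSubspace-intro
    (∈-ᗮ⁺ U 0v (λ v _ → B-zeroˡ v))
    (λ x y x∈ y∈ → ∈-ᗮ⁺ U _ (λ v v∈U →
       trans (additive x y v) (trans (cong₂ _+_ (∈-ᗮ⁻ U x x∈ v v∈U) (∈-ᗮ⁻ U y y∈ v v∈U)) (+-identityˡ 0#))))
    (λ c x x∈ → ∈-ᗮ⁺ U _ (λ v v∈U → trans (homogeneous c x v) (trans (cong (c *_) (∈-ᗮ⁻ U x x∈ v v∈U)) (zeroʳ c))))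

  ⊥-adjoin : ∀ Z v x → x ∈ₛ Z ᗮ → B x v ≡ 0# → x ∈ₛ adjoin Z v ᗮ
  ⊥-adjoin Z v x x∈ x⊥v = ∈-ᗮ⁺ _ x λ w w∈ → let (c , w-cv∈Z) = ∈-adjoin⁻ Z v w w∈ in begin
    B x w                               ≡⟨ cong (B x) (sym (-[]-+-cancel c w v)) ⟩
    B x (w -[ c ] v ⊞ c ⊙ v)            ≡⟨ B-additiveʳ x _ _ ⟩
    B x (w -[ c ] v) + B x (c ⊙ v)      ≡⟨ cong₂ _+_ (∈-ᗮ⁻ Z x x∈ _ w-cv∈Z) (trans (B-homogeneousʳ x c v) (cong (c *_) x⊥v)) ⟩
    0# + c * 0#                         ≡⟨ trans (+-identityˡ _) (zeroʳ c) ⟩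
    0# ∎
    where open ≡-Reasoning

  -- If (Z + ⟨v⟩)ᗮ ≠ Zᗮ, pick y₀ ∈ Zᗮ with B y₀ v ≠ 0: every y ∈ Zᗮ is y₀ times
  -- B y v / B y₀ v plus an element of (Z + ⟨v⟩)ᗮ, so Zᗮ ⊆ (Z + ⟨v⟩)ᗮ + ⟨y₀⟩.
  card-ᗮ-adjoin : ∀ Z v → IsSubspace Z → v ∈ᵇ Z ≡ false → card (Z ᗮ) ≤ q ℕ.* card (adjoin Z v ᗮ)
  card-ᗮ-adjoin Z v Z-sub v∉Z with Z ᗮ ⊆ᵇ adjoin Z v ᗮ in Zᗮ⊆
  ... | true = ℕP.≤-trans (card-mono _ _ (⊆ᵇ⇒⊆ _ _ Zᗮ⊆)) (ℕP.m≤n*m _ q)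
  ... | false with ⊆ᵇ-false⇒∃ (Z ᗮ) (adjoin Z v ᗮ) Zᗮ⊆
  ...   | y₀ , y₀∈ , y₀∉ = ℕP.≤-trans (card-mono _ _ cover) (ℕP.≤-reflexive (card-adjoin Y y₀ (ᗮ-isSubspace _) y₀∉))
    where
    Y : Sets
    Y = adjoin Z v ᗮ
    b : Fin q
    b = B y₀ v
    b≢0 : b ≢ 0#
    b≢0 b≡0 = true≢false (trans (sym (⊥-adjoin Z v y₀ y₀∈ b≡0)) y₀∉)
    cover : Z ᗮ ⊆ₛ adjoin Y y₀
    cover y y∈ = ∈-adjoin⁺ Y y₀ y c (⊥-adjoin Z v _ (-[]-closed (ᗮ-isSubspace Z) c y∈ y₀∈) y-cy₀⊥v)
      where
      c : Fin q
      c = B y v * b ⁻¹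
      open ≡-Reasoning
      y-cy₀⊥v : B (y -[ c ] y₀) v ≡ 0#
      y-cy₀⊥v = begin
        B (y -[ c ] y₀) v          ≡⟨ additive y _ v ⟩
        B y v + B ((- c) ⊙ y₀) v   ≡⟨ cong (B y v +_) (homogeneous (- c) y₀ v) ⟩
        B y v + (- c) * b          ≡⟨ cong (B y v +_) (sym (-‿distribˡ-* c b)) ⟩
        B y v + - (c * b)          ≡⟨ cong (λ z → B y v + - z) c*b≡Byv ⟩
        B y v + - B y v            ≡⟨ -‿inverseʳ _ ⟩
        0# ∎
        where
        c*b≡Byv : c * b ≡ B y v
        c*b≡Byv = begin
          B y v * b ⁻¹ * b     ≡⟨ *-assoc (B y v) (b ⁻¹) b ⟩
          B y v * (b ⁻¹ * b)   ≡⟨ cong (B y v *_) (⁻¹-inverseˡ b b≢0) ⟩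
          B y v * 1#           ≡⟨ *-identityʳ _ ⟩
          B y v                ∎

  zeroSᗮ≡E : zeroS ᗮ ≡ E
  zeroSᗮ≡E = ⊆-antisym _ _ (E-greatest _)
    (λ x _ → ∈-ᗮ⁺ zeroS x (λ v v∈ → trans (cong (B x) (∈-zeroS⁻ v v∈)) (trans (symmetric x 0v) (B-zeroˡ x))))

  Eᗮ≡zeroS : E ᗮ ≡ zeroS
  Eᗮ≡zeroS = ⊆-antisym _ _
    (λ x x∈ → ∈-zeroS⁺ x (nondegenerate x (λ y → ∈-ᗮ⁻ E x x∈ y (∈-E y))))
    (zeroS-least _ (ᗮ-isSubspace E))

  card*card-ᗮ : ∀ U → IsSubspace U → card U ℕ.* card (U ᗮ) ≡ q ^ n
  card*card-ᗮ U U-sub = ℕP.≤-antisym upper lower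
    where
    open ℕP.≤-Reasoning
    module G = Growth (λ U → card (U ᗮ)) card-ᗮ-adjoin
    lower : q ^ n ≤ card U ℕ.* card (U ᗮ)
    lower with G.grow zeroS U zeroS-isSubspace U-sub (zeroS-least U U-sub)
    ... | d , card-U , bound = begin
      q ^ n                       ≡⟨ trans (sym card-E) (cong card (sym zeroSᗮ≡E)) ⟩
      card (zeroS ᗮ)              ≤⟨ bound ⟩
      q ^ d ℕ.* card (U ᗮ)        ≡⟨ cong (ℕ._* card (U ᗮ)) (sym (trans card-U (trans (cong (q ^ d ℕ.*_) card-zeroS) (ℕP.*-identityʳ (q ^ d))))) ⟩
      card U ℕ.* card (U ᗮ)       ∎
    upper : card U ℕ.* card (U ᗮ) ≤ q ^ n
    upper with G.grow U E U-sub E-isSubspace (E-greatest U)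
    ... | d , card-E′ , bound = begin
      card U ℕ.* card (U ᗮ)              ≤⟨ ℕP.*-monoʳ-≤ (card U) bound ⟩
      card U ℕ.* (q ^ d ℕ.* card (E ᗮ))  ≡⟨ cong (λ z → card U ℕ.* (q ^ d ℕ.* card z)) Eᗮ≡zeroS ⟩
      card U ℕ.* (q ^ d ℕ.* card zeroS)  ≡⟨ cong (λ z → card U ℕ.* (q ^ d ℕ.* z)) card-zeroS ⟩
      card U ℕ.* (q ^ d ℕ.* 1)           ≡⟨ cong (card U ℕ.*_) (ℕP.*-identityʳ _) ⟩
      card U ℕ.* q ^ d                   ≡⟨ ℕP.*-comm (card U) _ ⟩
      q ^ d ℕ.* card U                   ≡⟨ sym card-E′ ⟩
      card E                             ≡⟨ card-E ⟩
      q ^ n                              ∎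

  dim+dim-ᗮ : ∀ U → IsSubspace U → dim U ℕ.+ dim (U ᗮ) ≡ n
  dim+dim-ᗮ U U-sub = ^-injectiveʳ q 2≤q (begin
    q ^ (dim U ℕ.+ dim (U ᗮ))        ≡⟨ ℕP.^-distribˡ-+-* q (dim U) (dim (U ᗮ)) ⟩
    q ^ dim U ℕ.* q ^ dim (U ᗮ)      ≡⟨ sym (cong₂ ℕ._*_ (card≡q^dim U U-sub) (card≡q^dim (U ᗮ) (ᗮ-isSubspace U))) ⟩
    card U ℕ.* card (U ᗮ)            ≡⟨ card*card-ᗮ U U-sub ⟩
    q ^ n                            ∎)
    where open ≡-Reasoning

  dim-ᗮ : ∀ U → IsSubspace U → dim (U ᗮ) ≡ n ℕ.∸ dim U
  dim-ᗮ U U-sub = sym (trans (cong (ℕ._∸ dim U) (sym (dim+dim-ᗮ U U-sub))) (ℕP.m+n∸m≡n (dim U) (dim (U ᗮ))))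

  ᗮ-involutive : ∀ U → IsSubspace U → U ᗮ ᗮ ≡ U
  ᗮ-involutive U U-sub = sym (subspace-⊆-card-≤⇒≡ U (U ᗮ ᗮ) U-sub (ᗮ-isSubspace _) U⊆Uᗮᗮ card≤)
    where
    U⊆Uᗮᗮ : U ⊆ₛ U ᗮ ᗮ
    U⊆Uᗮᗮ u u∈ = ∈-ᗮ⁺ _ u (λ x x∈ → trans (symmetric u x) (∈-ᗮ⁻ U x x∈ u u∈))
    card≤ : card (U ᗮ ᗮ) ≤ card U
    card≤ = ℕP.≤-reflexive (ℕP.*-cancelʳ-≡ (card (U ᗮ ᗮ)) (card U) (card (U ᗮ)) {{ℕ.>-nonZero (card-pos _ (ᗮ-isSubspace U))}}
      (trans (ℕP.*-comm _ (card (U ᗮ))) (trans (card*card-ᗮ (U ᗮ) (ᗮ-isSubspace U)) (sym (card*card-ᗮ U U-sub)))))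

  Σ-subspaces-ᗮ : ∀ (f : Sets → ℤ) → Σ subspaces (λ W → f (W ᗮ)) ≡ Σ subspaces f
  Σ-subspaces-ᗮ f = begin
    Σ subspaces (λ W → f (W ᗮ))
      ≡⟨ Σ-cong-∈ subspaces (λ W W∈ → sym (Σ-pick-subspace (W ᗮ) (ᗮ-isSubspace W) f)) ⟩
    Σ subspaces (λ W → Σ subspaces (λ U → if eqSet U (W ᗮ) then f U else 0ℤ))
      ≡⟨ Σ-swap subspaces subspaces _ ⟩
    Σ subspaces (λ U → Σ subspaces (λ W → if eqSet U (W ᗮ) then f U else 0ℤ))
      ≡⟨ Σ-cong-∈ subspaces (λ U U∈ → trans (Σ-cong-∈ subspaces (λ W W∈ → if-cong (eqSet-ᗮ U W (∈-subspaces⁻ U∈) (∈-subspaces⁻ W∈))))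
                                             (Σ-pick-subspace (U ᗮ) (ᗮ-isSubspace U) (λ _ → f U))) ⟩
    Σ subspaces f ∎
    where
    open ≡-Reasoning
    eqSet-ᗮ : ∀ U W → IsSubspace U → IsSubspace W → eqSet U (W ᗮ) ≡ eqSet W (U ᗮ)
    eqSet-ᗮ U W U-sub W-sub = ⇔-true⇒≡
      (λ U≡ → trans (cong (eqSet W) (trans (cong _ᗮ (eqSet⇒≡ U (W ᗮ) U≡)) (ᗮ-involutive W W-sub))) (eqSet-refl W))
      (λ W≡ → trans (cong (eqSet U) (trans (cong _ᗮ (eqSet⇒≡ W (U ᗮ) W≡)) (ᗮ-involutive U U-sub))) (eqSet-refl U))

module WeightEnumerators {q : ℕ} (F : FiniteField q) (n : ℕ) (B : Vec (Fin q) n → Vec (Fin q) n → Fin q)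
            (B-nondeg : QMatroid.IsNondegSymBilinear F n B) where

  open BoolLemmas
  open ListSum
  open GeometricSum
  open import Data.Nat as ℕ using (suc; _≤_; _^_; NonZero)
  open import Data.Nat.Properties as ℕP using ()
  open import Data.Nat.DivMod using (m*n/n≡m)
  open import Data.Integer using (0ℤ)
  open import Data.Fin.Subset using (∣_∣)
  open import Data.Bool using (false; if_then_else_)
  open import Data.Bool.Properties using (¬-not; if-cong)
  open import Data.Empty using (⊥)
  open import Data.Sum using (inj₁; inj₂)
  open import Relation.Binary.PropositionalEquality

  open Orthogonal F n B B-nondeg

  private
    p : ℕ
    p = q ℕ.∸ 1

    instance
      p-nonZero : NonZero p
      p-nonZero = qm1-nonZero F

    q^≡ : ∀ k → q ^ k ≡ suc p ^ k
    q^≡ k = cong (_^ k) (sym (ℕP.m+[n∸m]≡n {1} {q} (ℕP.<⇒≤ 2≤q)))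

  -- The number of points of PE off a subspace of dimension a.
  pointsOff : ℕ → ℕ
  pointsOff a = geometric p n ℕ.∸ geometric p a

  q^n∸q^≡ : ∀ a → q ^ n ℕ.∸ q ^ a ≡ pointsOff a ℕ.* p
  q^n∸q^≡ a = trans (cong₂ ℕ._∸_ (q^≡ n) (q^≡ a)) (trans (q^-difference p a n) (ℕP.*-comm p _))

  projSize≡pointsOff : ∀ i → projSize i ≡ pointsOff (n ℕ.∸ i)
  projSize≡pointsOff i = trans (cong (ℕ._/ p) (q^n∸q^≡ (n ℕ.∸ i))) (m*n/n≡m (pointsOff (n ℕ.∸ i)) p)

  ∣linesOutside∣≡pointsOff : ∀ U → IsSubspace U → ∣ linesOutside U ∣ ≡ pointsOff (dim U)
  ∣linesOutside∣≡pointsOff U U-sub = ℕP.*-cancelʳ-≡ _ _ p (begin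
    ∣ linesOutside U ∣ ℕ.* p                          ≡⟨ sym (ℕP.m+n∸n≡m _ (card U)) ⟩
    ∣ linesOutside U ∣ ℕ.* p ℕ.+ card U ℕ.∸ card U    ≡⟨ cong₂ ℕ._∸_ (∣linesOutside∣*[q-1]+card≡q^n U U-sub) (card≡q^dim U U-sub) ⟩
    q ^ n ℕ.∸ q ^ dim U                               ≡⟨ q^n∸q^≡ (dim U) ⟩
    pointsOff (dim U) ℕ.* p                           ∎)
    where open ≡-Reasoning

  pointsOff-injective : ∀ a b → a ≤ n → b ≤ n → pointsOff a ≡ pointsOff b → a ≡ b
  pointsOff-injective a b a≤n b≤n pa≡pb = ^-injectiveʳ q 2≤q (begin
    q ^ a                          ≡⟨ sym (ℕP.m∸[m∸n]≡n (ℕP.^-monoʳ-≤ q a≤n)) ⟩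
    q ^ n ℕ.∸ (q ^ n ℕ.∸ q ^ a)    ≡⟨ cong (q ^ n ℕ.∸_) (trans (q^n∸q^≡ a) (trans (cong (ℕ._* p) pa≡pb) (sym (q^n∸q^≡ b)))) ⟩
    q ^ n ℕ.∸ (q ^ n ℕ.∸ q ^ b)    ≡⟨ ℕP.m∸[m∸n]≡n (ℕP.^-monoʳ-≤ q b≤n) ⟩
    q ^ b                          ∎)
    where open ≡-Reasoning

  projWeightEnum≡weightEnum : ∀ ρ j i → i ≤ n → j ≡ projSize i → projWeightEnum ρ j ≈ₚ weightEnum B ρ i
  projWeightEnum≡weightEnum ρ j i i≤n j≡ k = begin
    projWeightEnum ρ j k
      ≡⟨ projWeightEnum≡Σ-subspaces ρ j k ⟩
    Σ subspaces (λ U → if ∣ linesOutside U ∣ ℕ.≡ᵇ j then χ/ ρ U k else 0ℤ)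
      ≡⟨ Σ-cong-∈ subspaces (λ U U∈ → if-cong (size≡j⇔dim≡n-i U (∈-subspaces⁻ U∈))) ⟩
    Σ subspaces (λ U → if dim U ℕ.≡ᵇ (n ℕ.∸ i) then χ/ ρ U k else 0ℤ)
      ≡⟨ sym (Σ-subspaces-ᗮ (λ U → if dim U ℕ.≡ᵇ (n ℕ.∸ i) then χ/ ρ U k else 0ℤ)) ⟩
    Σ subspaces (λ W → if dim (W ᗮ) ℕ.≡ᵇ (n ℕ.∸ i) then χ/ ρ (W ᗮ) k else 0ℤ)
      ≡⟨ Σ-cong-∈ subspaces (λ W W∈ → if-cong (dimᗮ≡n-i⇔dim≡i W (∈-subspaces⁻ W∈))) ⟩
    Σ subspaces (λ W → if dim W ℕ.≡ᵇ i then χ/ ρ (W ᗮ) k else 0ℤ)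
      ≡⟨ sym (Σ-filterᵇ (λ W → dim W ℕ.≡ᵇ i) subspaces (λ W → χ/ ρ (W ᗮ) k)) ⟩
    weightEnum B ρ i k ∎
    where
    open ≡-Reasoning
    size≡j⇔dim≡n-i : ∀ U → IsSubspace U → (∣ linesOutside U ∣ ℕ.≡ᵇ j) ≡ (dim U ℕ.≡ᵇ (n ℕ.∸ i))
    size≡j⇔dim≡n-i U U-sub = ≡ᵇ-cong _ _ _ _
      (λ e → pointsOff-injective (dim U) (n ℕ.∸ i) (dim≤n U U-sub) (ℕP.m∸n≤m n i)
               (trans (sym (∣linesOutside∣≡pointsOff U U-sub)) (trans e (trans j≡ (projSize≡pointsOff i)))))
      (λ e → trans (∣linesOutside∣≡pointsOff U U-sub) (trans (cong pointsOff e) (sym (trans j≡ (projSize≡pointsOff i)))))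
    dimᗮ≡n-i⇔dim≡i : ∀ W → IsSubspace W → (dim (W ᗮ) ℕ.≡ᵇ (n ℕ.∸ i)) ≡ (dim W ℕ.≡ᵇ i)
    dimᗮ≡n-i⇔dim≡i W W-sub = ≡ᵇ-cong _ _ _ _
      (λ e → trans (sym (ℕP.m∸[m∸n]≡n (dim≤n W W-sub)))
                   (trans (cong (n ℕ.∸_) (trans (sym (dim-ᗮ W W-sub)) e)) (ℕP.m∸[m∸n]≡n i≤n)))
      (λ e → trans (dim-ᗮ W W-sub) (cong (n ℕ.∸_) e))

  projWeightEnum≡0 : ∀ ρ j → 1 ≤ j → (∀ i → 1 ≤ i → i ≤ n → j ≢ projSize i) → projWeightEnum ρ j ≈ₚ 0ₚ
  projWeightEnum≡0 ρ j 1≤j j≢ k =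
    trans (projWeightEnum≡Σ-subspaces ρ j k)
          (trans (Σ-cong-∈ subspaces (λ U U∈ → if-cong (size≢j U (∈-subspaces⁻ U∈)))) (Σ-zero subspaces))
    where
    size≢j : ∀ U → IsSubspace U → (∣ linesOutside U ∣ ℕ.≡ᵇ j) ≡ false
    size≢j U U-sub = ¬-not (λ e → size≡j⇒⊥ (dim U) refl (trans (sym (∣linesOutside∣≡pointsOff U U-sub)) (≡ᵇ⇒≡ _ _ e)))
      where
      size≡j⇒⊥ : ∀ d → dim U ≡ d → pointsOff d ≡ j → ⊥
      size≡j⇒⊥ d dim≡d e with ℕP.m≤n⇒m<n∨m≡n (subst (_≤ n) dim≡d (dim≤n U U-sub))
      ... | inj₂ refl = ℕP.<⇒≱ 1≤j (ℕP.≤-reflexive (trans (sym e) (ℕP.n∸n≡0 (geometric p n))))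
      ... | inj₁ d<n  = j≢ (n ℕ.∸ d) (ℕP.m<n⇒0<n∸m d<n) (ℕP.m∸n≤m n d)
                          (trans (sym e) (trans (cong pointsOff (sym (ℕP.m∸[m∸n]≡n (ℕP.<⇒≤ d<n)))) (sym (projSize≡pointsOff (n ℕ.∸ d)))))

proposition6p10 : ∀ {q : ℕ} (F : FiniteField q) (n : ℕ)
    (B : Vec (Fin q) n → Vec (Fin q) n → Fin q) →
    QMatroid.IsNondegSymBilinear F n B →
    (ρ : VSet q n → ℕ) → QMatroid.IsQMatroid F n ρ →
    ∀ (j : ℕ) → 1 ≤ j → j ≤ QMatroid.numLines F n →
      ((∀ (i : ℕ) → 1 ≤ i → i ≤ n → j ≡ QMatroid.projSize F n i →
          QMatroid.projWeightEnum F n ρ j ≈ₚ QMatroid.weightEnum F n B ρ i)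
      × ((∀ (i : ℕ) → 1 ≤ i → i ≤ n → j ≢ QMatroid.projSize F n i) →
          QMatroid.projWeightEnum F n ρ j ≈ₚ 0ₚ))
proposition6p10 F n B B-nondeg ρ _ j 1≤j _ =
  (λ i _ i≤n → projWeightEnum≡weightEnum ρ j i i≤n) , projWeightEnum≡0 ρ j 1≤j
  where open WeightEnumerators F n B B-nondeg
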